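{- Let $M$ be a simple binary matroid. The following are equivalent. (i) $M$ is chordal. (ii) $M$ has no induced minor isomorphic to $M(C_4)$. (iii) $M$ has no induced restriction isomorphic to a member of $\{M(C_n):n\geq 4\}$.
   Context: A matroid $M$ is chordal if, for every circuit $D$ of $M$ with at least four elements, there exist circuits $D_1,D_2$ and an element $e$ with $D_1\cap D_2=\{e\}$ and $D=(D_1\cup D_2)-e$. All matroids are finite and simple; every contraction is immediately followed by simplification. An induced restriction of $M$ is $M|F$ for a flat $F$ of $M$; an induced minor is any matroid obtained by a sequence of contractions (followed by simplification) and restrictions to flats. $M(C_n)\cong U_{n-1,n}$ is the cycle matroid of the $n$-edge cycle. -}

module Defs where

open import Data.Nat using (ℕ; zero; suc; _<_; _≤_)
open import Data.Bool using (Bool; true; false; if_then_else_; _xor_)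
open import Data.Fin using (Fin)
open import Data.Fin.Subset using (Subset; _∈_; _∉_; _⊆_; ⁅_⁆; _∪_; _∩_; _-_; ∣_∣; ⊥)
open import Data.Vec using (Vec; []; _∷_; replicate; zipWith; tabulate; lookup)
open import Data.Product using (Σ; ∃; _×_; _,_)
open import Data.Sum using (_⊎_)
open import Relation.Nullary using (¬_)
open import Relation.Binary.PropositionalEquality using (_≡_; _≢_)
open import Function.Bundles using (_⇔_)

record Matroid (n : ℕ) : Set₁ where
  field
    Ind      : Subset n → Set
    ind-∅    : Ind ⊥
    ind-⊆    : ∀ {X Y} → Y ⊆ X → Ind X → Ind Y
    ind-aug  : ∀ {X Y} → Ind X → Ind Y → ∣ X ∣ < ∣ Y ∣ →
               ∃ λ e → e ∈ Y × e ∉ X × Ind (⁅ e ⁆ ∪ X)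
open Matroid public

-- "Independence predicate" on Fin k (used for targets / intermediate
-- matroids, which are only ever determined up to isomorphism).
IndPred : ℕ → Set₁
IndPred k = Subset k → Set

Simple : ∀ {n} → Matroid n → Set
Simple M = (∀ i → Ind M ⁅ i ⁆) × (∀ i j → i ≢ j → Ind M (⁅ i ⁆ ∪ ⁅ j ⁆))

_⊕_ : ∀ {r} → Vec Bool r → Vec Bool r → Vec Bool r
u ⊕ v = zipWith _xor_ u v

sumSub : ∀ {n r} → (Fin n → Vec Bool r) → Subset n → Vec Bool r
sumSub {zero}  {r} v []      = replicate r false
sumSub {suc n} {r} v (b ∷ Y) =
  (if b then v Fin.zero else replicate r false) ⊕ sumSub (λ i → v (Fin.suc i)) Y

LinIndepGF2 : ∀ {n r} → (Fin n → Vec Bool r) → Subset n → Set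
LinIndepGF2 {r = r} v X =
  ∀ Y → Y ⊆ X → sumSub v Y ≡ replicate r false → Y ≡ ⊥

Binary : ∀ {n} → Matroid n → Set
Binary {n} M = Σ ℕ λ r → Σ (Fin n → Vec Bool r) λ v →
  ∀ X → Ind M X ⇔ LinIndepGF2 v X

Circuit : ∀ {n} → Matroid n → Subset n → Set
Circuit M C = ¬ Ind M C × (∀ x → x ∈ C → Ind M (C - x))

Chordal : ∀ {n} → Matroid n → Set
Chordal M = ∀ D → Circuit M D → 4 ≤ ∣ D ∣ →
  ∃ λ D₁ → ∃ λ D₂ → ∃ λ e →
    Circuit M D₁ × Circuit M D₂ × (D₁ ∩ D₂ ≡ ⁅ e ⁆) × (D ≡ (D₁ ∪ D₂) - e)

-- F is a flat (closed set): x ∈ cl(F) (i.e. x lies in a circuit C with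
-- C - x ⊆ F) implies x ∈ F.
Flat : ∀ {n} → Matroid n → Subset n → Set
Flat M F = ∀ x C → Circuit M C → x ∈ C → C - x ⊆ F → x ∈ F

preimage : ∀ {m n} → (Fin m → Fin n) → Subset n → Subset m
preimage φ Y = tabulate (λ i → lookup Y (φ i))

Injective : ∀ {m n} → (Fin m → Fin n) → Set
Injective φ = ∀ i j → φ i ≡ φ j → i ≡ j

InImage : ∀ {m n} → (Fin m → Fin n) → Fin n → Set
InImage φ j = ∃ λ i → φ i ≡ j

-- N (on Fin k) is isomorphic to the induced restriction M|F for a
-- flat F of M: φ is a bijection Fin k → F respecting independence.
IsoInducedRestriction : ∀ {n k} → Matroid n → IndPred k → Set
IsoInducedRestriction M N =
  ∃ λ F → Flat M F × ∃ λ φ → Injective φ ×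
    (∀ j → (j ∈ F) ⇔ InImage φ j) ×
    (∀ Y → Y ⊆ F → Ind M Y ⇔ N (preimage φ Y))

ContrInd : ∀ {n} → Matroid n → Fin n → Subset n → Set
ContrInd M e X =
  (Ind M ⁅ e ⁆ → Ind M (X ∪ ⁅ e ⁆)) × (¬ Ind M ⁅ e ⁆ → Ind M X)

-- N (on Fin k) is isomorphic to the simplification si(M/e):
-- φ picks one representative of each parallel class of non-loops of
-- M/e, and N is isomorphic (via φ) to M/e restricted to those.
IsoContractSimplify : ∀ {n k} → Matroid n → IndPred k → Set
IsoContractSimplify M N =
  ∃ λ e → ∃ λ φ → Injective φ ×
    (∀ i → φ i ≢ e) ×
    (∀ i → ContrInd M e ⁅ φ i ⁆) ×
    (∀ i j → i ≢ j → ContrInd M e (⁅ φ i ⁆ ∪ ⁅ φ j ⁆)) ×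
    (∀ f → f ≢ e → ContrInd M e ⁅ f ⁆ →
       ∃ λ i → (f ≡ φ i) ⊎ ¬ ContrInd M e (⁅ f ⁆ ∪ ⁅ φ i ⁆)) ×
    (∀ Y → (∀ j → j ∈ Y → InImage φ j) →
       ContrInd M e Y ⇔ N (preimage φ Y))

IsoMatroid : ∀ {n k} → Matroid n → IndPred k → Set
IsoMatroid M N = ∃ λ φ → Injective φ × (∀ j → InImage φ j) ×
  (∀ Y → Ind M Y ⇔ N (preimage φ Y))

-- Intermediate matroids P are arbitrary
-- matroids related to the previous one by the step relation (each
-- step holds up to isomorphism).
data IndMinorOf : ∀ {n k} → Matroid n → IndPred k → Set₁ where
  done  : ∀ {n k} {M : Matroid n} {N : IndPred k} →
          IsoMatroid M N → IndMinorOf M N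
  restr : ∀ {n j k} {M : Matroid n} {P : Matroid j} {N : IndPred k} →
          IsoInducedRestriction M (Ind P) → IndMinorOf P N → IndMinorOf M N
  contr : ∀ {n j k} {M : Matroid n} {P : Matroid j} {N : IndPred k} →
          IsoContractSimplify M (Ind P) → IndMinorOf P N → IndMinorOf M N

-- M(C_n) ≅ U_{n-1,n}: on Fin n, a set is independent iff it has < n
-- elements (for n ≥ 1).
CycleInd : (k : ℕ) → IndPred k
CycleInd k X = ∣ X ∣ < k

-- Fix a GF(2)-representation v of M and call a circuit with at least four elements that is also
-- a flat a long flat circuit; these are exactly the induced restrictions isomorphic to M(C_k),
-- k ≥ 4. A chord e of a flat circuit C would give a circuit D₁ with D₁ - e ⊆ C but e ∉ C, so a
-- chordal matroid has none. Conversely, if a circuit D is not a flat then v x = Σ v(A) for some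
-- x ∉ D and A ⊆ D, and ⁅x⁆ ∪ A and ⁅x⁆ ∪ (D ─ A) are circuits meeting exactly in x.
--
-- Contracting an element of M(C_k) gives M(C_{k-1}), so a long flat circuit yields M(C₄) as an
-- induced minor. In the other direction, long flat circuits lift back along every step of an
-- induced minor. Through a restriction to a flat they are simply transported. Contracting e is
-- represented by g ∘ v for an additive projection g with kernel {0, v e}, so the image D of a long
-- flat circuit of si(M/e) has Σ v(D) ∈ {0, v e}. If the sum is 0 then D itself is a long flat
-- circuit of M; otherwise ⁅e⁆ ∪ D is one, unless v x = v d + v e for some d ∈ D, in which case
-- exchanging d for x gives a set with the same image under g ∘ v and v-sum 0, and that set is one.

module Submission where

open import Defs
open import Data.Nat using (ℕ; zero; suc; _≤_; _<_; z≤n; s≤s; _+_)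
import Data.Nat.Properties as ℕₚ
open import Data.Bool using (Bool; true; false; _∨_; _∧_; not; _xor_; if_then_else_)
import Data.Bool.Properties as Boolₚ
open import Data.Fin as Fin using (Fin; zero; suc)
import Data.Fin.Properties as Finₚ
open import Data.Fin.Subset
  using (Subset; _∈_; _∉_; _⊆_; ⁅_⁆; _∪_; _∩_; _-_; _─_; ∣_∣; ⊥; ⊤; Nonempty)
import Data.Fin.Subset.Properties as Subsetₚ
open import Data.Vec using (Vec; []; _∷_; lookup; tabulate; replicate; zipWith; here; there)
import Data.Vec.Properties as Vecₚ
open import Data.Product as Product using (Σ-syntax; ∃; ∃-syntax; _×_; _,_; proj₁; proj₂)
open import Data.Sum using (_⊎_; inj₁; inj₂)
open import Data.Empty using (⊥-elim)
open import Function using (id; _∘_)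
open import Function.Bundles using (_⇔_; mk⇔; Equivalence)
open import Relation.Nullary using (¬_; Dec; yes; no; does; ¬?; _×-dec_)
open import Relation.Nullary.Decidable using (decidable-stable; dec-true; dec-false)
open import Relation.Binary.PropositionalEquality
import Relation.Binary.Reasoning.Setoid
open import Function.Properties.Equivalence using (⇔-setoid)
open import Level using (0ℓ)

private
  variable
    n r : ℕ
    p q C : Subset n
    x y i : Fin n

-- Subsets as Boolean vectors

lookup-ext : {A : Set} {u w : Vec A n} → (∀ i → lookup u i ≡ lookup w i) → u ≡ w
lookup-ext {u = u} {w} eq = begin
  u                   ≡⟨ Vecₚ.tabulate∘lookup u ⟨
  tabulate (lookup u) ≡⟨ Vecₚ.tabulate-cong eq ⟩
  tabulate (lookup w) ≡⟨ Vecₚ.tabulate∘lookup w ⟩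
  w                   ∎
  where open ≡-Reasoning

true≢false : true ≢ false
true≢false ()

∈⇒lookup : x ∈ p → lookup p x ≡ true
∈⇒lookup = Vecₚ.[]=⇒lookup

lookup⇒∈ : lookup p x ≡ true → x ∈ p
lookup⇒∈ {p = p} {x = x} = Vecₚ.lookup⇒[]= x p

∉⇒lookup : x ∉ p → lookup p x ≡ false
∉⇒lookup {x = x} {p = p} x∉p with lookup p x in eq
... | true  = ⊥-elim (x∉p (lookup⇒∈ eq))
... | false = refl

lookup⇒∉ : lookup p x ≡ false → x ∉ p
lookup⇒∉ eq x∈p = true≢false (trans (sym (∈⇒lookup x∈p)) eq)

lookup-⊆ : (∀ i → lookup p i ≡ true → lookup q i ≡ true) → p ⊆ q
lookup-⊆ h x∈p = lookup⇒∈ (h _ (∈⇒lookup x∈p))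

⊆-lookup : p ⊆ q → ∀ i → lookup p i ≡ true → lookup q i ≡ true
⊆-lookup p⊆q i eq = ∈⇒lookup (p⊆q (lookup⇒∈ eq))

lookup-∪ : ∀ (p q : Subset n) i → lookup (p ∪ q) i ≡ lookup p i ∨ lookup q i
lookup-∪ p q i = Vecₚ.lookup-zipWith _∨_ i p q

lookup-∩ : ∀ (p q : Subset n) i → lookup (p ∩ q) i ≡ lookup p i ∧ lookup q i
lookup-∩ p q i = Vecₚ.lookup-zipWith _∧_ i p q

lookup-─ : ∀ (p q : Subset n) i → lookup (p ─ q) i ≡ lookup p i ∧ not (lookup q i)
lookup-─ (a ∷ p) (b ∷ q) zero    with a | b
... | true  | true  = refl
... | true  | false = refl
... | false | true  = refl
... | false | false = refl
lookup-─ (a ∷ p) (b ∷ q) (suc i) = lookup-─ p q i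

lookup-⁅x⁆-x : ∀ (x : Fin n) → lookup ⁅ x ⁆ x ≡ true
lookup-⁅x⁆-x x = ∈⇒lookup (Subsetₚ.x∈⁅x⁆ x)

lookup-⁅x⁆-≢ : x ≢ i → lookup ⁅ x ⁆ i ≡ false
lookup-⁅x⁆-≢ x≢i = ∉⇒lookup (λ i∈⁅x⁆ → x≢i (sym (Subsetₚ.x∈⁅y⁆⇒x≡y _ i∈⁅x⁆)))

lookup-minus-x : ∀ (p : Subset n) x → lookup (p - x) x ≡ false
lookup-minus-x p x rewrite lookup-─ p ⁅ x ⁆ x | lookup-⁅x⁆-x x = Boolₚ.∧-zeroʳ _

lookup-minus-≢ : ∀ (p : Subset n) → x ≢ i → lookup (p - x) i ≡ lookup p i
lookup-minus-≢ {x = x} {i = i} p x≢i = begin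
  lookup (p - x) i                  ≡⟨ lookup-─ p ⁅ x ⁆ i ⟩
  lookup p i ∧ not (lookup ⁅ x ⁆ i) ≡⟨ cong (λ b → lookup p i ∧ not b) (lookup-⁅x⁆-≢ x≢i) ⟩
  lookup p i ∧ true                 ≡⟨ Boolₚ.∧-identityʳ _ ⟩
  lookup p i                        ∎
  where open ≡-Reasoning

lookup-minus⇒ : ∀ (p : Subset n) x → lookup (p - x) i ≡ true → lookup p i ≡ true × x ≢ i
lookup-minus⇒ {i = i} p x eq with x Fin.≟ i
... | yes refl = ⊥-elim (true≢false (trans (sym eq) (lookup-minus-x p x)))
... | no x≢i   = trans (sym (lookup-minus-≢ p x≢i)) eq , x≢i

minus-⊆ : ∀ (p : Subset n) x → p - x ⊆ p
minus-⊆ p x = lookup-⊆ λ i eq → proj₁ (lookup-minus⇒ p x eq)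

⊆-minus : p ⊆ q → x ∉ p → p ⊆ q - x
⊆-minus {p = p} {q = q} {x = x} p⊆q x∉p = lookup-⊆ h
  where
  h : ∀ i → lookup p i ≡ true → lookup (q - x) i ≡ true
  h i eq with x Fin.≟ i
  ... | yes refl = ⊥-elim (x∉p (lookup⇒∈ eq))
  ... | no x≢i   = trans (lookup-minus-≢ q x≢i) (⊆-lookup p⊆q i eq)

⊆-or-witness : ∀ (p q : Subset n) → p ⊆ q ⊎ ∃[ x ] (x ∈ p × x ∉ q)
⊆-or-witness p q with Finₚ.any? (λ x → x Subsetₚ.∈? p ×-dec ¬? (x Subsetₚ.∈? q))
... | yes witness = inj₂ witness
... | no ¬witness = inj₁ λ {x} x∈p →
  decidable-stable (x Subsetₚ.∈? q) (λ x∉q → ¬witness (x , x∈p , x∉q))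

infixr 6 _Δ_
_Δ_ : Subset n → Subset n → Subset n
p Δ q = zipWith _xor_ p q

lookup-Δ : ∀ (p q : Subset n) i → lookup (p Δ q) i ≡ lookup p i xor lookup q i
lookup-Δ p q i = Vecₚ.lookup-zipWith _xor_ i p q

Δ-⊆ : {s : Subset n} → p ⊆ s → q ⊆ s → p Δ q ⊆ s
Δ-⊆ {p = p} {q = q} {s = s} p⊆s q⊆s = lookup-⊆ λ i eq → h i (trans (sym (lookup-Δ p q i)) eq)
  where
  h : ∀ i → lookup p i xor lookup q i ≡ true → lookup s i ≡ true
  h i eq with lookup p i in p[i]
  ... | true  = ⊆-lookup p⊆s i p[i]
  ... | false = ⊆-lookup q⊆s i eq

─≡Δ : q ⊆ p → p ─ q ≡ p Δ q
─≡Δ {q = q} {p = p} q⊆p = lookup-ext λ i → trans (lookup-─ p q i) (trans (h i) (sym (lookup-Δ p q i)))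
  where
  h : ∀ i → lookup p i ∧ not (lookup q i) ≡ lookup p i xor lookup q i
  h i with lookup q i in q[i]
  ... | true  rewrite ⊆-lookup q⊆p i q[i] = refl
  ... | false = trans (Boolₚ.∧-identityʳ _) (sym (Boolₚ.xor-identityʳ _))

insert-minus : x ∈ p → ⁅ x ⁆ ∪ (p - x) ≡ p
insert-minus {x = x} {p = p} x∈p = lookup-ext h
  where
  h : ∀ i → lookup (⁅ x ⁆ ∪ (p - x)) i ≡ lookup p i
  h i rewrite lookup-∪ ⁅ x ⁆ (p - x) i with x Fin.≟ i
  ... | yes refl rewrite lookup-⁅x⁆-x x = sym (∈⇒lookup x∈p)
  ... | no x≢i   rewrite lookup-⁅x⁆-≢ x≢i = lookup-minus-≢ p x≢i

minus-∉ : x ∉ p → p - x ≡ p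
minus-∉ {x = x} {p = p} x∉p = lookup-ext h
  where
  h : ∀ i → lookup (p - x) i ≡ lookup p i
  h i with x Fin.≟ i
  ... | yes refl = trans (lookup-minus-x p x) (sym (∉⇒lookup x∉p))
  ... | no x≢i   = lookup-minus-≢ p x≢i

∪-disjoint≡Δ : x ∉ p → ⁅ x ⁆ ∪ p ≡ ⁅ x ⁆ Δ p
∪-disjoint≡Δ {x = x} {p = p} x∉p = lookup-ext λ i →
  trans (lookup-∪ ⁅ x ⁆ p i) (trans (h i) (sym (lookup-Δ ⁅ x ⁆ p i)))
  where
  h : ∀ i → lookup ⁅ x ⁆ i ∨ lookup p i ≡ lookup ⁅ x ⁆ i xor lookup p i
  h i with x Fin.≟ i
  ... | yes refl rewrite lookup-⁅x⁆-x x | ∉⇒lookup x∉p = refl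
  ... | no x≢i   rewrite lookup-⁅x⁆-≢ x≢i = refl

∣p∣≡1+∣p-x∣ : x ∈ p → ∣ p ∣ ≡ suc ∣ p - x ∣
∣p∣≡1+∣p-x∣ {x = zero}  {true  ∷ p} here        = cong (suc ∘ ∣_∣) (sym (Subsetₚ.p─⊥≡p p))
∣p∣≡1+∣p-x∣ {x = suc x} {true  ∷ p} (there x∈p) = cong suc (∣p∣≡1+∣p-x∣ x∈p)
∣p∣≡1+∣p-x∣ {x = suc x} {false ∷ p} (there x∈p) = ∣p∣≡1+∣p-x∣ x∈p

∣⁅x⁆∪p∣≡1+∣p∣ : x ∉ p → ∣ ⁅ x ⁆ ∪ p ∣ ≡ suc ∣ p ∣
∣⁅x⁆∪p∣≡1+∣p∣ {x = zero}  {true  ∷ p} x∉p = ⊥-elim (x∉p here)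
∣⁅x⁆∪p∣≡1+∣p∣ {x = zero}  {false ∷ p} x∉p = cong (suc ∘ ∣_∣) (Subsetₚ.∪-identityˡ p)
∣⁅x⁆∪p∣≡1+∣p∣ {x = suc x} {true  ∷ p} x∉p = cong suc (∣⁅x⁆∪p∣≡1+∣p∣ (x∉p ∘ there))
∣⁅x⁆∪p∣≡1+∣p∣ {x = suc x} {false ∷ p} x∉p = ∣⁅x⁆∪p∣≡1+∣p∣ (x∉p ∘ there)

∈⇒≢⊥ : x ∈ p → p ≢ ⊥
∈⇒≢⊥ {x = x} x∈p p≡⊥ = Subsetₚ.∉⊥ (subst (x ∈_) p≡⊥ x∈p)

⊆⊥⇒≡⊥ : p ⊆ ⊥ → p ≡ ⊥
⊆⊥⇒≡⊥ p⊆⊥ = Subsetₚ.⊆-antisym p⊆⊥ Subsetₚ.⊥⊆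

─≡⊥⇒⊆ : p ─ q ≡ ⊥ → p ⊆ q
─≡⊥⇒⊆ {p = p} {q = q} p─q≡⊥ {y} y∈p = decidable-stable (y Subsetₚ.∈? q)
  (λ y∉q → ∈⇒≢⊥ (Subsetₚ.x∈p∧x∉q⇒x∈p─q y∈p y∉q) p─q≡⊥)

minus-⊆-∪ : q ⊆ ⁅ x ⁆ ∪ p → q - x ⊆ p
minus-⊆-∪ {q = q} {x = x} {p = p} q⊆ y∈q-x with lookup-minus⇒ q x (∈⇒lookup y∈q-x)
... | q[y] , x≢y with Subsetₚ.x∈p∪q⁻ ⁅ x ⁆ p (q⊆ (lookup⇒∈ q[y]))
...   | inj₁ y∈⁅x⁆ = ⊥-elim (x≢y (sym (Subsetₚ.x∈⁅y⁆⇒x≡y x y∈⁅x⁆)))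
...   | inj₂ y∈p   = y∈p

⁅x⁆⊆ : x ∈ p → ⁅ x ⁆ ⊆ p
⁅x⁆⊆ {x = x} {p = p} x∈p y∈⁅x⁆ = subst (_∈ p) (sym (Subsetₚ.x∈⁅y⁆⇒x≡y x y∈⁅x⁆)) x∈p

⊆-⁅x⁆ : p ⊆ ⁅ x ⁆ → p ≡ ⊥ ⊎ p ≡ ⁅ x ⁆
⊆-⁅x⁆ {p = p} {x = x} p⊆⁅x⁆ with x Subsetₚ.∈? p
... | yes x∈p = inj₂ (Subsetₚ.⊆-antisym p⊆⁅x⁆ (⁅x⁆⊆ x∈p))
... | no  x∉p = inj₁ (⊆⊥⇒≡⊥ λ y∈p →
  ⊥-elim (x∉p (subst (_∈ p) (Subsetₚ.x∈⁅y⁆⇒x≡y x (p⊆⁅x⁆ y∈p)) y∈p)))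

∪-⊆ : {s : Subset n} → p ⊆ s → q ⊆ s → p ∪ q ⊆ s
∪-⊆ {p = p} {q = q} p⊆s q⊆s x∈p∪q with Subsetₚ.x∈p∪q⁻ p q x∈p∪q
... | inj₁ x∈p = p⊆s x∈p
... | inj₂ x∈q = q⊆s x∈q

x∈⁅x⁆∪p : ∀ (p : Subset n) x → x ∈ ⁅ x ⁆ ∪ p
x∈⁅x⁆∪p p x = Subsetₚ.p⊆p∪q p (Subsetₚ.x∈⁅x⁆ x)

minus-mono : p ⊆ q → p - x ⊆ q - x
minus-mono {p = p} {x = x} p⊆q = ⊆-minus (p⊆q ∘ minus-⊆ p x) (lookup⇒∉ (lookup-minus-x p x))

∉⇒∣p∣<n : ∀ {n} {p : Subset n} {x} → x ∉ p → ∣ p ∣ < n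
∉⇒∣p∣<n {n} {p} x∉p = subst (∣ p ∣ <_) (Subsetₚ.∣⊤∣≡n n)
  (Subsetₚ.p⊂q⇒∣p∣<∣q∣ (Subsetₚ.⊆⊤ , _ , Subsetₚ.∈⊤ , x∉p))

-- Vectors over GF(2)

𝟎 : ∀ r → Vec Bool r
𝟎 r = replicate r false

infixr 25 _·_
_·_ : Bool → Vec Bool r → Vec Bool r
b · u = if b then u else 𝟎 _

module _ {r : ℕ} where

  ⊕-comm : ∀ (u w : Vec Bool r) → u ⊕ w ≡ w ⊕ u
  ⊕-comm = Vecₚ.zipWith-comm Boolₚ.xor-comm

  ⊕-assoc : ∀ (u w z : Vec Bool r) → (u ⊕ w) ⊕ z ≡ u ⊕ (w ⊕ z)
  ⊕-assoc = Vecₚ.zipWith-assoc Boolₚ.xor-assoc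

  ⊕-identityˡ : ∀ (u : Vec Bool r) → 𝟎 r ⊕ u ≡ u
  ⊕-identityˡ = Vecₚ.zipWith-identityˡ Boolₚ.xor-identityˡ

  ⊕-identityʳ : ∀ (u : Vec Bool r) → u ⊕ 𝟎 r ≡ u
  ⊕-identityʳ = Vecₚ.zipWith-identityʳ Boolₚ.xor-identityʳ

⊕-self : ∀ (u : Vec Bool r) → u ⊕ u ≡ 𝟎 r
⊕-self []      = refl
⊕-self (a ∷ u) = cong₂ _∷_ (Boolₚ.xor-same a) (⊕-self u)

⊕-cancelˡ : ∀ (u w : Vec Bool r) → u ⊕ (u ⊕ w) ≡ w
⊕-cancelˡ u w = begin
  u ⊕ (u ⊕ w) ≡⟨ ⊕-assoc u u w ⟨
  (u ⊕ u) ⊕ w ≡⟨ cong (_⊕ w) (⊕-self u) ⟩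
  𝟎 _ ⊕ w     ≡⟨ ⊕-identityˡ w ⟩
  w           ∎
  where open ≡-Reasoning

⊕-cancelʳ : ∀ (u w : Vec Bool r) → (u ⊕ w) ⊕ w ≡ u
⊕-cancelʳ u w = trans (⊕-assoc u w w) (trans (cong (u ⊕_) (⊕-self w)) (⊕-identityʳ u))

⊕-interchange : ∀ (a b c d : Vec Bool r) → (a ⊕ b) ⊕ (c ⊕ d) ≡ (a ⊕ c) ⊕ (b ⊕ d)
⊕-interchange a b c d = begin
  (a ⊕ b) ⊕ (c ⊕ d) ≡⟨ ⊕-assoc a b (c ⊕ d) ⟩
  a ⊕ (b ⊕ (c ⊕ d)) ≡⟨ cong (a ⊕_) (⊕-assoc b c d) ⟨
  a ⊕ ((b ⊕ c) ⊕ d) ≡⟨ cong (λ z → a ⊕ (z ⊕ d)) (⊕-comm b c) ⟩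
  a ⊕ ((c ⊕ b) ⊕ d) ≡⟨ cong (a ⊕_) (⊕-assoc c b d) ⟩
  a ⊕ (c ⊕ (b ⊕ d)) ≡⟨ ⊕-assoc a c (b ⊕ d) ⟨
  (a ⊕ c) ⊕ (b ⊕ d) ∎
  where open ≡-Reasoning

⊕≡𝟎⇒≡ : {u w : Vec Bool r} → u ⊕ w ≡ 𝟎 r → u ≡ w
⊕≡𝟎⇒≡ {u = u} {w} eq = begin
  u           ≡⟨ ⊕-identityʳ u ⟨
  u ⊕ 𝟎 _     ≡⟨ cong (u ⊕_) (⊕-self w) ⟨
  u ⊕ (w ⊕ w) ≡⟨ ⊕-assoc u w w ⟨
  (u ⊕ w) ⊕ w ≡⟨ cong (_⊕ w) eq ⟩
  𝟎 _ ⊕ w     ≡⟨ ⊕-identityˡ w ⟩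
  w           ∎
  where open ≡-Reasoning

≡⇒⊕≡𝟎 : {u w : Vec Bool r} → u ≡ w → u ⊕ w ≡ 𝟎 r
≡⇒⊕≡𝟎 {u = u} refl = ⊕-self u

⊕-transpose : {a b c : Vec Bool r} → a ≡ b ⊕ c → c ≡ b ⊕ a
⊕-transpose {b = b} {c} a≡b⊕c = sym (trans (cong (b ⊕_) a≡b⊕c) (⊕-cancelˡ b c))

xor-· : ∀ a b (u : Vec Bool r) → (a xor b) · u ≡ a · u ⊕ b · u
xor-· true  true  u = sym (⊕-self u)
xor-· true  false u = sym (⊕-identityʳ u)
xor-· false b     u = sym (⊕-identityˡ _)

Additive : ∀ {r s} → (Vec Bool r → Vec Bool s) → Set
Additive g = ∀ u w → g (u ⊕ w) ≡ g u ⊕ g w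

additive-𝟎 : ∀ {s} {g : Vec Bool r → Vec Bool s} → Additive g → g (𝟎 r) ≡ 𝟎 s
additive-𝟎 {r = r} {g = g} additive = begin
  g (𝟎 r)                   ≡⟨ ⊕-cancelˡ (g (𝟎 r)) (g (𝟎 r)) ⟨
  g (𝟎 r) ⊕ (g (𝟎 r) ⊕ g (𝟎 r)) ≡⟨ cong (g (𝟎 r) ⊕_) (additive (𝟎 r) (𝟎 r)) ⟨
  g (𝟎 r) ⊕ g (𝟎 r ⊕ 𝟎 r)   ≡⟨ cong (λ z → g (𝟎 r) ⊕ g z) (⊕-self (𝟎 r)) ⟩
  g (𝟎 r) ⊕ g (𝟎 r)         ≡⟨ ⊕-self (g (𝟎 r)) ⟩
  𝟎 _                       ∎
  where open ≡-Reasoning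

sumSub-⊥ : ∀ (v : Fin n → Vec Bool r) → sumSub v ⊥ ≡ 𝟎 r
sumSub-⊥ {n = zero}  v = refl
sumSub-⊥ {n = suc n} v = trans (⊕-identityˡ _) (sumSub-⊥ (v ∘ suc))

sumSub-⁅⁆ : ∀ (v : Fin n → Vec Bool r) i → sumSub v ⁅ i ⁆ ≡ v i
sumSub-⁅⁆ v zero    = trans (cong (v zero ⊕_) (sumSub-⊥ (v ∘ suc))) (⊕-identityʳ _)
sumSub-⁅⁆ v (suc i) = trans (⊕-identityˡ _) (sumSub-⁅⁆ (v ∘ suc) i)

sumSub-Δ : ∀ (v : Fin n → Vec Bool r) p q → sumSub v (p Δ q) ≡ sumSub v p ⊕ sumSub v q
sumSub-Δ v []      []      = sym (⊕-self _)
sumSub-Δ v (a ∷ p) (b ∷ q) = begin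
  (a xor b) · v zero ⊕ sumSub (v ∘ suc) (p Δ q)
    ≡⟨ cong₂ _⊕_ (xor-· a b (v zero)) (sumSub-Δ (v ∘ suc) p q) ⟩
  (a · v zero ⊕ b · v zero) ⊕ (sumSub (v ∘ suc) p ⊕ sumSub (v ∘ suc) q)
    ≡⟨ ⊕-interchange _ _ _ _ ⟩
  (a · v zero ⊕ sumSub (v ∘ suc) p) ⊕ (b · v zero ⊕ sumSub (v ∘ suc) q) ∎
  where open ≡-Reasoning

sumSub-insert : ∀ (v : Fin n → Vec Bool r) → x ∉ p → sumSub v (⁅ x ⁆ ∪ p) ≡ v x ⊕ sumSub v p
sumSub-insert {x = x} {p = p} v x∉p = begin
  sumSub v (⁅ x ⁆ ∪ p)           ≡⟨ cong (sumSub v) (∪-disjoint≡Δ x∉p) ⟩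
  sumSub v (⁅ x ⁆ Δ p)           ≡⟨ sumSub-Δ v ⁅ x ⁆ p ⟩
  sumSub v ⁅ x ⁆ ⊕ sumSub v p    ≡⟨ cong (_⊕ sumSub v p) (sumSub-⁅⁆ v x) ⟩
  v x ⊕ sumSub v p               ∎
  where open ≡-Reasoning

sumSub-minus : ∀ (v : Fin n → Vec Bool r) → x ∈ p → sumSub v p ≡ v x ⊕ sumSub v (p - x)
sumSub-minus {x = x} {p = p} v x∈p = begin
  sumSub v p                 ≡⟨ cong (sumSub v) (insert-minus x∈p) ⟨
  sumSub v (⁅ x ⁆ ∪ (p - x)) ≡⟨ sumSub-insert v (lookup⇒∉ (lookup-minus-x p x)) ⟩
  v x ⊕ sumSub v (p - x)     ∎
  where open ≡-Reasoning

sumSub-minus-𝟎 : ∀ (v : Fin n → Vec Bool r) → v x ≡ 𝟎 r → sumSub v (p - x) ≡ sumSub v p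
sumSub-minus-𝟎 {x = x} {p = p} v vx≡𝟎 with x Subsetₚ.∈? p
... | no  x∉p = cong (sumSub v) (minus-∉ x∉p)
... | yes x∈p = begin
  sumSub v (p - x)          ≡⟨ ⊕-identityˡ _ ⟨
  𝟎 _ ⊕ sumSub v (p - x)    ≡⟨ cong (_⊕ sumSub v (p - x)) vx≡𝟎 ⟨
  v x ⊕ sumSub v (p - x)    ≡⟨ sumSub-minus v x∈p ⟨
  sumSub v p                ∎
  where open ≡-Reasoning

sumSub-─ : ∀ (v : Fin n → Vec Bool r) → q ⊆ p → sumSub v (p ─ q) ≡ sumSub v p ⊕ sumSub v q
sumSub-─ {q = q} {p = p} v q⊆p = trans (cong (sumSub v) (─≡Δ q⊆p)) (sumSub-Δ v p q)

sum≡𝟎⇒≡sum-rest : ∀ (v : Fin n → Vec Bool r) → x ∈ p → sumSub v p ≡ 𝟎 r →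
                  v x ≡ sumSub v (p - x)
sum≡𝟎⇒≡sum-rest v x∈p sum≡𝟎 = ⊕≡𝟎⇒≡ (trans (sym (sumSub-minus v x∈p)) sum≡𝟎)

sumSub-additive : ∀ {s} {g : Vec Bool r → Vec Bool s} → Additive g →
                  ∀ (v : Fin n → Vec Bool r) p → sumSub (g ∘ v) p ≡ g (sumSub v p)
sumSub-additive additive v []      = sym (additive-𝟎 additive)
sumSub-additive {g = g} additive v (b ∷ p) =
  trans (cong₂ _⊕_ (·-additive b) (sumSub-additive additive (v ∘ suc) p)) (sym (additive _ _))
  where
  ·-additive : ∀ b → b · g (v zero) ≡ g (b · v zero)
  ·-additive true  = refl
  ·-additive false = sym (additive-𝟎 additive)

private
  image? : ∀ {m} (φ : Fin m → Fin n) X j → Dec (∃[ i ] (i ∈ X × φ i ≡ j))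
  image? φ X j = Finₚ.any? λ i → i Subsetₚ.∈? X ×-dec φ i Fin.≟ j

image : ∀ {m} → (Fin m → Fin n) → Subset m → Subset n
image φ X = tabulate (does ∘ image? φ X)

module _ {m : ℕ} (φ : Fin m → Fin n) where

  ∈-image⁺ : {X : Subset m} {i : Fin m} → i ∈ X → φ i ∈ image φ X
  ∈-image⁺ {X} {i} i∈X =
    lookup⇒∈ (trans (Vecₚ.lookup∘tabulate _ (φ i)) (dec-true (image? φ X (φ i)) (i , i∈X , refl)))

  ∈-image⁻ : {X : Subset m} {j : Fin n} → j ∈ image φ X → ∃[ i ] (i ∈ X × φ i ≡ j)
  ∈-image⁻ {X} {j} j∈ = decidable-stable (image? φ X j) λ ¬witness →
    true≢false (trans (sym (trans (sym (Vecₚ.lookup∘tabulate _ j)) (∈⇒lookup j∈)))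
                      (dec-false (image? φ X j) ¬witness))

  ∈-preimage⁺ : {Y : Subset n} {i : Fin m} → φ i ∈ Y → i ∈ preimage φ Y
  ∈-preimage⁺ {i = i} φi∈Y = lookup⇒∈ (trans (Vecₚ.lookup∘tabulate _ i) (∈⇒lookup φi∈Y))

  ∈-preimage⁻ : {Y : Subset n} {i : Fin m} → i ∈ preimage φ Y → φ i ∈ Y
  ∈-preimage⁻ {i = i} i∈ = lookup⇒∈ (trans (sym (Vecₚ.lookup∘tabulate _ i)) (∈⇒lookup i∈))

  ∈-image⇒InImage : {X : Subset m} {j : Fin n} → j ∈ image φ X → InImage φ j
  ∈-image⇒InImage j∈ with ∈-image⁻ j∈
  ... | i , _ , φi≡j = i , φi≡j

  image-mono : {X Z : Subset m} → X ⊆ Z → image φ X ⊆ image φ Z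
  image-mono X⊆Z j∈ with ∈-image⁻ j∈
  ... | i , i∈X , refl = ∈-image⁺ (X⊆Z i∈X)

  preimage-mono : {Y Z : Subset n} → Y ⊆ Z → preimage φ Y ⊆ preimage φ Z
  preimage-mono Y⊆Z = ∈-preimage⁺ ∘ Y⊆Z ∘ ∈-preimage⁻

  image-⊥ : image φ ⊥ ≡ ⊥
  image-⊥ = ⊆⊥⇒≡⊥ λ j∈ → ⊥-elim (Subsetₚ.∉⊥ (∈-image⁻ j∈ .proj₂ .proj₁))

  preimage-⊥ : preimage φ ⊥ ≡ ⊥
  preimage-⊥ = ⊆⊥⇒≡⊥ λ i∈ → ⊥-elim (Subsetₚ.∉⊥ (∈-preimage⁻ i∈))

  preimage-image : Injective φ → ∀ X → preimage φ (image φ X) ≡ X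
  preimage-image φ-inj X = Subsetₚ.⊆-antisym sub (∈-preimage⁺ ∘ ∈-image⁺)
    where
    sub : preimage φ (image φ X) ⊆ X
    sub {i} i∈ with ∈-image⁻ (∈-preimage⁻ i∈)
    ... | i′ , i′∈X , φi′≡φi = subst (_∈ X) (φ-inj i′ i φi′≡φi) i′∈X

  image-preimage : {Y : Subset n} → (∀ j → j ∈ Y → InImage φ j) → image φ (preimage φ Y) ≡ Y
  image-preimage {Y} Y⊆range = Subsetₚ.⊆-antisym sub sup
    where
    sub : image φ (preimage φ Y) ⊆ Y
    sub j∈ with ∈-image⁻ j∈
    ... | i , i∈ , refl = ∈-preimage⁻ i∈
    sup : Y ⊆ image φ (preimage φ Y)
    sup {j} j∈Y with Y⊆range j j∈Y
    ... | i , refl = ∈-image⁺ (∈-preimage⁺ j∈Y)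

module _ {m : ℕ} {φ : Fin (suc m) → Fin n} where

  image-suc⊆ : ∀ b X → image (φ ∘ suc) X ⊆ image φ (b ∷ X)
  image-suc⊆ b X j∈ with ∈-image⁻ (φ ∘ suc) j∈
  ... | i , i∈X , refl = ∈-image⁺ φ (there i∈X)

  image-outside∷ : ∀ X → image φ (false ∷ X) ≡ image (φ ∘ suc) X
  image-outside∷ X = Subsetₚ.⊆-antisym sub (image-suc⊆ false X)
    where
    sub : image φ (false ∷ X) ⊆ image (φ ∘ suc) X
    sub j∈ with ∈-image⁻ φ {X = false ∷ X} j∈
    ... | zero  , ()        , _
    ... | suc i , there i∈X , refl = ∈-image⁺ (φ ∘ suc) i∈X

  image-inside∷ : ∀ X → image φ (true ∷ X) ≡ ⁅ φ zero ⁆ ∪ image (φ ∘ suc) X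
  image-inside∷ X = Subsetₚ.⊆-antisym sub sup
    where
    sub : image φ (true ∷ X) ⊆ ⁅ φ zero ⁆ ∪ image (φ ∘ suc) X
    sub j∈ with ∈-image⁻ φ {X = true ∷ X} j∈
    ... | zero  , _          , refl = x∈⁅x⁆∪p _ (φ zero)
    ... | suc i , there i∈X , refl = Subsetₚ.q⊆p∪q ⁅ φ zero ⁆ _ (∈-image⁺ (φ ∘ suc) i∈X)
    sup : ⁅ φ zero ⁆ ∪ image (φ ∘ suc) X ⊆ image φ (true ∷ X)
    sup j∈ with Subsetₚ.x∈p∪q⁻ ⁅ φ zero ⁆ _ j∈
    ... | inj₁ j∈⁅φ0⁆ rewrite Subsetₚ.x∈⁅y⁆⇒x≡y (φ zero) j∈⁅φ0⁆ = ∈-image⁺ φ here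
    ... | inj₂ j∈     = image-suc⊆ true X j∈

  φ0∉image-suc : Injective φ → ∀ X → φ zero ∉ image (φ ∘ suc) X
  φ0∉image-suc φ-inj X φ0∈ with ∈-image⁻ (φ ∘ suc) φ0∈
  ... | i , _ , φsi≡φ0 = Finₚ.0≢1+n (φ-inj zero (suc i) (sym φsi≡φ0))

Injective-suc : ∀ {m} {φ : Fin (suc m) → Fin n} → Injective φ → Injective (φ ∘ suc)
Injective-suc φ-inj i j φsi≡φsj = Finₚ.suc-injective (φ-inj (suc i) (suc j) φsi≡φsj)

sumSub-image : ∀ {m} (w : Fin n → Vec Bool r) {φ : Fin m → Fin n} → Injective φ → ∀ X →
               sumSub (w ∘ φ) X ≡ sumSub w (image φ X)
sumSub-image w {φ} φ-inj [] = trans (sym (sumSub-⊥ w)) (cong (sumSub w) (sym (image-⊥ φ)))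
sumSub-image w {φ} φ-inj (false ∷ X) = begin
  𝟎 _ ⊕ sumSub (w ∘ φ ∘ suc) X         ≡⟨ ⊕-identityˡ _ ⟩
  sumSub (w ∘ φ ∘ suc) X               ≡⟨ sumSub-image w (Injective-suc φ-inj) X ⟩
  sumSub w (image (φ ∘ suc) X)         ≡⟨ cong (sumSub w) (image-outside∷ {φ = φ} X) ⟨
  sumSub w (image φ (false ∷ X))       ∎
  where open ≡-Reasoning
sumSub-image w {φ} φ-inj (true ∷ X) = begin
  w (φ zero) ⊕ sumSub (w ∘ φ ∘ suc) X
    ≡⟨ cong (w (φ zero) ⊕_) (sumSub-image w (Injective-suc φ-inj) X) ⟩
  w (φ zero) ⊕ sumSub w (image (φ ∘ suc) X)
    ≡⟨ sumSub-insert w (φ0∉image-suc φ-inj X) ⟨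
  sumSub w (⁅ φ zero ⁆ ∪ image (φ ∘ suc) X)
    ≡⟨ cong (sumSub w) (image-inside∷ {φ = φ} X) ⟨
  sumSub w (image φ (true ∷ X)) ∎
  where open ≡-Reasoning

∣image∣ : ∀ {m} {φ : Fin m → Fin n} → Injective φ → ∀ X → ∣ image φ X ∣ ≡ ∣ X ∣
∣image∣ {n = n} {φ = φ} φ-inj [] = trans (cong ∣_∣ (image-⊥ φ)) (Subsetₚ.∣⊥∣≡0 n)
∣image∣ {φ = φ} φ-inj (false ∷ X) =
  trans (cong ∣_∣ (image-outside∷ {φ = φ} X)) (∣image∣ (Injective-suc φ-inj) X)
∣image∣ {φ = φ} φ-inj (true ∷ X) = begin
  ∣ image φ (true ∷ X) ∣             ≡⟨ cong ∣_∣ (image-inside∷ {φ = φ} X) ⟩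
  ∣ ⁅ φ zero ⁆ ∪ image (φ ∘ suc) X ∣ ≡⟨ ∣⁅x⁆∪p∣≡1+∣p∣ (φ0∉image-suc φ-inj X) ⟩
  suc ∣ image (φ ∘ suc) X ∣          ≡⟨ cong suc (∣image∣ (Injective-suc φ-inj) X) ⟩
  suc ∣ X ∣                          ∎
  where open ≡-Reasoning

enumerate : ∀ (p : Subset n) →
            Σ[ χ ∈ (Fin ∣ p ∣ → Fin n) ] (Injective χ × ∀ j → j ∈ p ⇔ InImage χ j)
enumerate []          = (λ ()) , (λ ()) , (λ ())
enumerate (false ∷ p) with enumerate p
... | χ , χ-inj , χ-onto = suc ∘ χ , (λ i j → χ-inj i j ∘ Finₚ.suc-injective) , onto
  where
  onto : ∀ j → j ∈ false ∷ p ⇔ InImage (suc ∘ χ) j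
  onto zero    = mk⇔ (λ ()) (λ ())
  onto (suc j) = mk⇔
    (λ { (there j∈p) → Product.map₂ (cong suc) (Equivalence.to (χ-onto j) j∈p) })
    (λ (i , sχi≡sj) → there (Equivalence.from (χ-onto j) (i , Finₚ.suc-injective sχi≡sj)))
enumerate (true ∷ p) with enumerate p
... | χ , χ-inj , χ-onto = χ′ , χ′-inj , onto
  where
  χ′ : Fin (suc ∣ p ∣) → Fin (suc _)
  χ′ zero    = zero
  χ′ (suc i) = suc (χ i)
  χ′-inj : Injective χ′
  χ′-inj zero    zero    _ = refl
  χ′-inj (suc i) (suc j) eq = cong suc (χ-inj i j (Finₚ.suc-injective eq))
  onto : ∀ j → j ∈ true ∷ p ⇔ InImage χ′ j
  onto zero    = mk⇔ (λ _ → zero , refl) (λ _ → here)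
  onto (suc j) = mk⇔
    (λ { (there j∈p) → Product.map suc (cong suc) (Equivalence.to (χ-onto j) j∈p) })
    (λ { (suc i , sχi≡sj) → there (Equivalence.from (χ-onto j) (i , Finₚ.suc-injective sχi≡sj)) })

preimage≡⊤ : ∀ {m} {φ : Fin m → Fin n} → (∀ i → φ i ∈ p) → preimage φ p ≡ ⊤
preimage≡⊤ {φ = φ} φi∈p = Subsetₚ.⊆-antisym Subsetₚ.⊆⊤ λ {i} _ → ∈-preimage⁺ φ (φi∈p i)

-- Independent sets and circuits of families of GF(2)-vectors

record SimpleFamily (v : Fin n → Vec Bool r) : Set where
  field
    nonzero   : ∀ i → v i ≢ 𝟎 r
    injective : ∀ i j → v i ≡ v j → i ≡ j

record VecCircuit (v : Fin n → Vec Bool r) (C : Subset n) : Set where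
  field
    nonempty : Nonempty C
    sum≡𝟎    : sumSub v C ≡ 𝟎 r
    minimal  : ∀ Z → Z ⊆ C → sumSub v Z ≡ 𝟎 r → Z ≡ ⊥ ⊎ Z ≡ C

InSpan : (Fin n → Vec Bool r) → Subset n → Fin n → Set
InSpan v F x = ∃[ A ] (A ⊆ F × v x ≡ sumSub v A)

Closed : (Fin n → Vec Bool r) → Subset n → Set
Closed v F = ∀ x → InSpan v F x → x ∈ F

HasLongClosedCircuit : (Fin n → Vec Bool r) → Set
HasLongClosedCircuit v = ∃[ C ] (VecCircuit v C × Closed v C × 4 ≤ ∣ C ∣)

module _ (v : Fin n → Vec Bool r) where

  LI-⊥ : LinIndepGF2 v ⊥
  LI-⊥ Z Z⊆⊥ _ = ⊆⊥⇒≡⊥ Z⊆⊥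

  LI-insert : LinIndepGF2 v p → ¬ InSpan v p x → LinIndepGF2 v (⁅ x ⁆ ∪ p)
  LI-insert {p = p} {x = x} li x∉span Z Z⊆ Z-sum with x Subsetₚ.∈? Z
  ... | yes x∈Z = ⊥-elim (x∉span (Z - x , minus-⊆-∪ Z⊆ , sum≡𝟎⇒≡sum-rest v x∈Z Z-sum))
  ... | no  x∉Z = li Z (subst (_⊆ p) (minus-∉ x∉Z) (minus-⊆-∪ Z⊆)) Z-sum

  LI-single : v x ≢ 𝟎 r → LinIndepGF2 v ⁅ x ⁆
  LI-single {x = x} vx≢𝟎 = subst (LinIndepGF2 v) (Subsetₚ.∪-identityʳ ⁅ x ⁆) (LI-insert LI-⊥ x∉span)
    where
    x∉span : ¬ InSpan v ⊥ x
    x∉span (A , A⊆⊥ , vx≡ΣA) with ⊆⊥⇒≡⊥ A⊆⊥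
    ... | refl = vx≢𝟎 (trans vx≡ΣA (sumSub-⊥ v))

  LI-pair : v x ≢ 𝟎 r → v y ≢ 𝟎 r → v x ≢ v y → LinIndepGF2 v (⁅ x ⁆ ∪ ⁅ y ⁆)
  LI-pair {x = x} {y = y} vx≢𝟎 vy≢𝟎 vx≢vy = LI-insert (LI-single vy≢𝟎) x∉span
    where
    x∉span : ¬ InSpan v ⁅ y ⁆ x
    x∉span (A , A⊆⁅y⁆ , vx≡) with ⊆-⁅x⁆ A⊆⁅y⁆
    ... | inj₁ refl = vx≢𝟎 (trans vx≡ (sumSub-⊥ v))
    ... | inj₂ refl = vx≢vy (trans vx≡ (sumSub-⁅⁆ v y))

  LI-single⇒≢𝟎 : LinIndepGF2 v ⁅ x ⁆ → v x ≢ 𝟎 r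
  LI-single⇒≢𝟎 {x = x} li vx≡𝟎 =
    ∈⇒≢⊥ (Subsetₚ.x∈⁅x⁆ x) (li ⁅ x ⁆ id (trans (sumSub-⁅⁆ v x) vx≡𝟎))

  LI-pair⇒≢ : x ≢ y → LinIndepGF2 v (⁅ x ⁆ ∪ ⁅ y ⁆) → v x ≢ v y
  LI-pair⇒≢ {x = x} {y = y} x≢y li vx≡vy = ∈⇒≢⊥ (x∈⁅x⁆∪p ⁅ y ⁆ x) (li _ id pair-sum)
    where
    pair-sum : sumSub v (⁅ x ⁆ ∪ ⁅ y ⁆) ≡ 𝟎 r
    pair-sum = trans (sumSub-insert v (Subsetₚ.x≢y⇒x∉⁅y⁆ x≢y))
                     (trans (cong (v x ⊕_) (sumSub-⁅⁆ v y)) (≡⇒⊕≡𝟎 vx≡vy))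

  ¬LI⇒dependent : ¬ LinIndepGF2 v p → ∃[ Z ] (Z ⊆ p × sumSub v Z ≡ 𝟎 r × Nonempty Z)
  ¬LI⇒dependent {p = p} ¬li with Subsetₚ.anySubset? (λ Z →
    Z Subsetₚ.⊆? p ×-dec Vecₚ.≡-dec Boolₚ._≟_ (sumSub v Z) (𝟎 r) ×-dec Subsetₚ.nonempty? Z)
  ... | yes dependent = dependent
  ... | no ¬dependent = ⊥-elim (¬li λ Z Z⊆p Z-sum →
          Subsetₚ.Empty-unique (λ nonempty → ¬dependent (Z , Z⊆p , Z-sum , nonempty)))

  fundamental-circuit : LinIndepGF2 v p → x ∉ p → v x ≡ sumSub v p → VecCircuit v (⁅ x ⁆ ∪ p)
  fundamental-circuit {p = p} {x = x} li x∉p vx≡ = record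
    { nonempty = x , x∈⁅x⁆∪p p x
    ; sum≡𝟎    = trans (sumSub-insert v x∉p) (≡⇒⊕≡𝟎 vx≡)
    ; minimal  = minimal
    }
    where
    minimal : ∀ Z → Z ⊆ ⁅ x ⁆ ∪ p → sumSub v Z ≡ 𝟎 r → Z ≡ ⊥ ⊎ Z ≡ ⁅ x ⁆ ∪ p
    minimal Z Z⊆ Z-sum with x Subsetₚ.∈? Z
    ... | no  x∉Z = inj₁ (li Z (subst (_⊆ p) (minus-∉ x∉Z) (minus-⊆-∪ Z⊆)) Z-sum)
    ... | yes x∈Z = inj₂ (trans (sym (insert-minus x∈Z)) (cong (⁅ x ⁆ ∪_) Z-x≡p))
      where
      Z-x⊆p : Z - x ⊆ p
      Z-x⊆p = minus-⊆-∪ Z⊆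
      p─[Z-x]≡⊥ : p ─ (Z - x) ≡ ⊥
      p─[Z-x]≡⊥ = li _ (Subsetₚ.p─q⊆p p (Z - x)) (begin
        sumSub v (p ─ (Z - x))           ≡⟨ sumSub-─ v Z-x⊆p ⟩
        sumSub v p ⊕ sumSub v (Z - x)    ≡⟨ cong₂ _⊕_ vx≡ (sum≡𝟎⇒≡sum-rest v x∈Z Z-sum) ⟨
        v x ⊕ v x                        ≡⟨ ⊕-self (v x) ⟩
        𝟎 r                              ∎)
        where open ≡-Reasoning
      Z-x≡p : Z - x ≡ p
      Z-x≡p = Subsetₚ.⊆-antisym Z-x⊆p (─≡⊥⇒⊆ p─[Z-x]≡⊥)

  module _ {C : Subset n} (circuit : VecCircuit v C) where
    open VecCircuit circuit

    proper-independent : p ⊆ C → x ∈ C → x ∉ p → LinIndepGF2 v p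
    proper-independent p⊆C x∈C x∉p Z Z⊆p Z-sum with minimal Z (p⊆C ∘ Z⊆p) Z-sum
    ... | inj₁ Z≡⊥ = Z≡⊥
    ... | inj₂ refl = ⊥-elim (x∉p (Z⊆p x∈C))

    chord : (∀ i → v i ≢ 𝟎 r) → x ∉ C → p ⊆ C → v x ≡ sumSub v p →
            VecCircuit v (⁅ x ⁆ ∪ p)
    chord {x = x} {p = p} nonzero x∉C p⊆C vx≡Σp with ⊆-or-witness C p
    ... | inj₁ C⊆p rewrite Subsetₚ.⊆-antisym p⊆C C⊆p = ⊥-elim (nonzero x (trans vx≡Σp sum≡𝟎))
    ... | inj₂ (d , d∈C , d∉p) =
      fundamental-circuit (proper-independent p⊆C d∈C d∉p) (x∉C ∘ p⊆C) vx≡Σp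

InSpan? : ∀ (v : Fin n → Vec Bool r) p x → Dec (InSpan v p x)
InSpan? v p x = Subsetₚ.anySubset? λ A →
  A Subsetₚ.⊆? p ×-dec Vecₚ.≡-dec Boolₚ._≟_ (v x) (sumSub v A)

module _ (w : Fin n → Vec Bool r) {m : ℕ} {φ : Fin m → Fin n} (φ-inj : Injective φ) where

  private
    ⊆image⇒range : {X : Subset m} {Z : Subset n} → Z ⊆ image φ X → ∀ j → j ∈ Z → InImage φ j
    ⊆image⇒range Z⊆ j = ∈-image⇒InImage φ ∘ Z⊆

    preimage-⊆ : {X : Subset m} {Z : Subset n} → Z ⊆ image φ X → preimage φ Z ⊆ X
    preimage-⊆ {X} Z⊆ = subst (_ ⊆_) (preimage-image φ φ-inj X) (preimage-mono φ Z⊆)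

    sumSub-preimage : {X : Subset m} {Z : Subset n} → Z ⊆ image φ X →
                      sumSub (w ∘ φ) (preimage φ Z) ≡ sumSub w Z
    sumSub-preimage {Z = Z} Z⊆ =
      trans (sumSub-image w φ-inj (preimage φ Z)) (cong (sumSub w) (image-preimage φ (⊆image⇒range Z⊆)))

    ≡image-preimage : {X : Subset m} {Z : Subset n} → Z ⊆ image φ X → Z ≡ image φ (preimage φ Z)
    ≡image-preimage Z⊆ = sym (image-preimage φ (⊆image⇒range Z⊆))

  LI-image : ∀ X → LinIndepGF2 (w ∘ φ) X ⇔ LinIndepGF2 w (image φ X)
  LI-image X = mk⇔ to from
    where
    to : LinIndepGF2 (w ∘ φ) X → LinIndepGF2 w (image φ X)
    to li Z Z⊆ Z-sum = begin
      Z                        ≡⟨ ≡image-preimage Z⊆ ⟩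
      image φ (preimage φ Z)
        ≡⟨ cong (image φ) (li _ (preimage-⊆ Z⊆) (trans (sumSub-preimage Z⊆) Z-sum)) ⟩
      image φ ⊥                ≡⟨ image-⊥ φ ⟩
      ⊥                        ∎
      where open ≡-Reasoning
    from : LinIndepGF2 w (image φ X) → LinIndepGF2 (w ∘ φ) X
    from li Z Z⊆X Z-sum = begin
      Z                        ≡⟨ preimage-image φ φ-inj Z ⟨
      preimage φ (image φ Z)
        ≡⟨ cong (preimage φ) (li _ (image-mono φ Z⊆X) (trans (sym (sumSub-image w φ-inj Z)) Z-sum)) ⟩
      preimage φ ⊥             ≡⟨ preimage-⊥ φ ⟩
      ⊥                        ∎
      where open ≡-Reasoning

  VecCircuit-image : VecCircuit (w ∘ φ) C → VecCircuit w (image φ C)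
  VecCircuit-image {C = C} circuit = record
    { nonempty = φ (nonempty .proj₁) , ∈-image⁺ φ (nonempty .proj₂)
    ; sum≡𝟎    = trans (sym (sumSub-image w φ-inj C)) sum≡𝟎
    ; minimal  = minimal′
    }
    where
    open VecCircuit circuit
    minimal′ : ∀ Z → Z ⊆ image φ C → sumSub w Z ≡ 𝟎 r → Z ≡ ⊥ ⊎ Z ≡ image φ C
    minimal′ Z Z⊆ Z-sum with minimal (preimage φ Z) (preimage-⊆ Z⊆) (trans (sumSub-preimage Z⊆) Z-sum)
    ... | inj₁ pre≡⊥ = inj₁ (trans (≡image-preimage Z⊆) (trans (cong (image φ) pre≡⊥) (image-⊥ φ)))
    ... | inj₂ pre≡C = inj₂ (trans (≡image-preimage Z⊆) (cong (image φ) pre≡C))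

  InSpan-image : InSpan w (image φ C) y → w y ≡ w (φ i) → InSpan (w ∘ φ) C i
  InSpan-image (A , A⊆ , wy≡) wy≡wφi =
    preimage φ A , preimage-⊆ A⊆ , trans (sym wy≡wφi) (trans wy≡ (sym (sumSub-preimage A⊆)))

-- Binary matroids

record Represents (M : Matroid n) (v : Fin n → Vec Bool r) : Set where
  constructor mkRepresents
  field
    ind⇔LI : ∀ X → Ind M X ⇔ LinIndepGF2 v X

HasLongFlatCircuit : Matroid n → Set
HasLongFlatCircuit M = ∃[ C ] (Circuit M C × Flat M C × 4 ≤ ∣ C ∣)

module _ {M : Matroid n} {v : Fin n → Vec Bool r} (rep : Represents M v) where

  private
    ind⇒LI : Ind M p → LinIndepGF2 v p
    ind⇒LI = Equivalence.to (Represents.ind⇔LI rep _)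

    LI⇒ind : LinIndepGF2 v p → Ind M p
    LI⇒ind = Equivalence.from (Represents.ind⇔LI rep _)

  simple⇒SimpleFamily : Simple M → SimpleFamily v
  simple⇒SimpleFamily (ind-single , ind-pair) = record
    { nonzero   = λ i → LI-single⇒≢𝟎 v (ind⇒LI (ind-single i))
    ; injective = injective
    }
    where
    injective : ∀ i j → v i ≡ v j → i ≡ j
    injective i j vi≡vj with i Fin.≟ j
    ... | yes i≡j = i≡j
    ... | no  i≢j = ⊥-elim (LI-pair⇒≢ v i≢j (ind⇒LI (ind-pair i j i≢j)) vi≡vj)

  circuit-minimal : Circuit M C → ∀ Z → Z ⊆ C → sumSub v Z ≡ 𝟎 r → Z ≡ ⊥ ⊎ Z ≡ C
  circuit-minimal {C = C} (_ , ind-minus) Z Z⊆C Z-sum with ⊆-or-witness C Z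
  ... | inj₁ C⊆Z = inj₂ (Subsetₚ.⊆-antisym Z⊆C C⊆Z)
  ... | inj₂ (c , c∈C , c∉Z) = inj₁ (ind⇒LI (ind-minus c c∈C) Z (⊆-minus Z⊆C c∉Z) Z-sum)

  circuit⇒VecCircuit : Circuit M C → VecCircuit v C
  circuit⇒VecCircuit circuit@(dependent , _) with ¬LI⇒dependent v (dependent ∘ LI⇒ind)
  ... | Z , Z⊆C , Z-sum , (z , z∈Z) with circuit-minimal circuit Z Z⊆C Z-sum
  ...   | inj₁ Z≡⊥  = ⊥-elim (∈⇒≢⊥ z∈Z Z≡⊥)
  ...   | inj₂ refl = record { nonempty = z , z∈Z ; sum≡𝟎 = Z-sum ; minimal = circuit-minimal circuit }

  VecCircuit⇒circuit : VecCircuit v C → Circuit M C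
  VecCircuit⇒circuit {C = C} circuit = dependent , ind-minus
    where
    open VecCircuit circuit
    dependent : ¬ Ind M C
    dependent ind = ∈⇒≢⊥ (nonempty .proj₂) (ind⇒LI ind C id sum≡𝟎)
    ind-minus : ∀ x → x ∈ C → Ind M (C - x)
    ind-minus x x∈C =
      LI⇒ind (proper-independent v circuit (minus-⊆ C x) x∈C (lookup⇒∉ (lookup-minus-x C x)))

  closed⇒flat : Closed v p → Flat M p
  closed⇒flat closed x K K-circuit x∈K K-x⊆p = closed x (K - x , K-x⊆p , vx≡Σ[K-x])
    where
    vx≡Σ[K-x] : v x ≡ sumSub v (K - x)
    vx≡Σ[K-x] = sum≡𝟎⇒≡sum-rest v x∈K (VecCircuit.sum≡𝟎 (circuit⇒VecCircuit K-circuit))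

  flat-InSpan : SimpleFamily v → Flat M p → VecCircuit v q → q ⊆ p → InSpan v q x → x ∈ p
  flat-InSpan {x = x} simple flat circuit q⊆p (A , A⊆q , vx≡) with x Subsetₚ.∈? _
  ... | yes x∈q = q⊆p x∈q
  ... | no  x∉q = flat x (⁅ x ⁆ ∪ A)
      (VecCircuit⇒circuit (chord v circuit (SimpleFamily.nonzero simple) x∉q A⊆q vx≡))
      (x∈⁅x⁆∪p A x) (q⊆p ∘ A⊆q ∘ minus-⊆-∪ id)

  flat⇒closed : SimpleFamily v → Circuit M p → Flat M p → Closed v p
  flat⇒closed simple circuit flat x = flat-InSpan simple flat (circuit⇒VecCircuit circuit) id

  longFlatCircuit⇔ : SimpleFamily v → HasLongFlatCircuit M ⇔ HasLongClosedCircuit v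
  longFlatCircuit⇔ simple = mk⇔
    (λ (C , circuit , flat , 4≤∣C∣) →
      C , circuit⇒VecCircuit circuit , flat⇒closed simple circuit flat , 4≤∣C∣)
    (λ (C , circuit , closed , 4≤∣C∣) →
      C , VecCircuit⇒circuit circuit , closed⇒flat closed , 4≤∣C∣)

-- Chordality

chordal⇒¬longFlatCircuit : ∀ (M : Matroid n) → Chordal M → ¬ HasLongFlatCircuit M
chordal⇒¬longFlatCircuit M chordal (C , circuit , flat , 4≤∣C∣) with chordal C circuit 4≤∣C∣
... | D₁ , D₂ , e , D₁-circuit , _ , D₁∩D₂≡⁅e⁆ , C≡ =
  e∉C (flat e D₁ D₁-circuit e∈D₁ D₁-e⊆C)
  where
  e∈D₁ : e ∈ D₁
  e∈D₁ = Subsetₚ.p∩q⊆p D₁ D₂ (subst (e ∈_) (sym D₁∩D₂≡⁅e⁆) (Subsetₚ.x∈⁅x⁆ e))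
  e∉C : e ∉ C
  e∉C = lookup⇒∉ (trans (cong (λ S → lookup S e) C≡) (lookup-minus-x (D₁ ∪ D₂) e))
  D₁-e⊆C : D₁ - e ⊆ C
  D₁-e⊆C = subst (D₁ - e ⊆_) (sym C≡) (minus-mono (Subsetₚ.p⊆p∪q D₂))

chord-split : {A D : Subset n} → A ⊆ D → x ∉ D →
  (⁅ x ⁆ ∪ A) ∩ (⁅ x ⁆ ∪ (D ─ A)) ≡ ⁅ x ⁆ × D ≡ (⁅ x ⁆ ∪ A) ∪ (⁅ x ⁆ ∪ (D ─ A)) - x
chord-split {x = x} {A = A} {D = D} A⊆D x∉D = lookup-ext meet , lookup-ext join
  where
  a∧[d∧¬a]≡false : ∀ a d → a ∧ (d ∧ not a) ≡ false
  a∧[d∧¬a]≡false true  d = Boolₚ.∧-zeroʳ d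
  a∧[d∧¬a]≡false false d = refl
  a∨[d∧¬a]≡d : ∀ a d → (a ≡ true → d ≡ true) → a ∨ (d ∧ not a) ≡ d
  a∨[d∧¬a]≡d true  d a⇒d = sym (a⇒d refl)
  a∨[d∧¬a]≡d false d _   = Boolₚ.∧-identityʳ d
  meet : ∀ i → lookup ((⁅ x ⁆ ∪ A) ∩ (⁅ x ⁆ ∪ (D ─ A))) i ≡ lookup ⁅ x ⁆ i
  meet i rewrite lookup-∩ (⁅ x ⁆ ∪ A) (⁅ x ⁆ ∪ (D ─ A)) i
               | lookup-∪ ⁅ x ⁆ A i | lookup-∪ ⁅ x ⁆ (D ─ A) i | lookup-─ D A i with x Fin.≟ i
  ... | yes refl rewrite lookup-⁅x⁆-x x = refl
  ... | no  x≢i  rewrite lookup-⁅x⁆-≢ x≢i = a∧[d∧¬a]≡false (lookup A i) (lookup D i)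
  join : ∀ i → lookup D i ≡ lookup ((⁅ x ⁆ ∪ A) ∪ (⁅ x ⁆ ∪ (D ─ A)) - x) i
  join i with x Fin.≟ i
  ... | yes refl =
    trans (∉⇒lookup x∉D) (sym (lookup-minus-x ((⁅ x ⁆ ∪ A) ∪ (⁅ x ⁆ ∪ (D ─ A))) x))
  ... | no  x≢i  rewrite lookup-minus-≢ ((⁅ x ⁆ ∪ A) ∪ (⁅ x ⁆ ∪ (D ─ A))) x≢i
                       | lookup-∪ (⁅ x ⁆ ∪ A) (⁅ x ⁆ ∪ (D ─ A)) i
                       | lookup-∪ ⁅ x ⁆ A i | lookup-∪ ⁅ x ⁆ (D ─ A) i | lookup-─ D A i
                       | lookup-⁅x⁆-≢ x≢i =
    sym (a∨[d∧¬a]≡d (lookup A i) (lookup D i) (⊆-lookup A⊆D i))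

module _ {M : Matroid n} {v : Fin n → Vec Bool r} (rep : Represents M v) (simple : SimpleFamily v) where

  ¬longFlatCircuit⇒chordal : ¬ HasLongFlatCircuit M → Chordal M
  ¬longFlatCircuit⇒chordal ¬long D D-circuit 4≤∣D∣
    with Finₚ.any? (λ x → ¬? (x Subsetₚ.∈? D) ×-dec InSpan? v D x)
  ... | no ¬chord = ⊥-elim (¬long (D , D-circuit , closed⇒flat rep closed , 4≤∣D∣))
    where
    closed : Closed v D
    closed x span = decidable-stable (x Subsetₚ.∈? D) (λ x∉D → ¬chord (x , x∉D , span))
  ... | yes (x , x∉D , A , A⊆D , vx≡ΣA) =
    ⁅ x ⁆ ∪ A , ⁅ x ⁆ ∪ (D ─ A) , x ,
    VecCircuit⇒circuit rep (chord v D-vc nonzero x∉D A⊆D vx≡ΣA) ,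
    VecCircuit⇒circuit rep (chord v D-vc nonzero x∉D (Subsetₚ.p─q⊆p D A) vx≡Σ[D─A]) ,
    chord-split A⊆D x∉D
    where
    open SimpleFamily simple
    D-vc = circuit⇒VecCircuit rep D-circuit
    vx≡Σ[D─A] : v x ≡ sumSub v (D ─ A)
    vx≡Σ[D─A] = begin
      v x                        ≡⟨ vx≡ΣA ⟩
      sumSub v A                 ≡⟨ ⊕-identityˡ _ ⟨
      𝟎 r ⊕ sumSub v A           ≡⟨ cong (_⊕ sumSub v A) (VecCircuit.sum≡𝟎 D-vc) ⟨
      sumSub v D ⊕ sumSub v A    ≡⟨ sumSub-─ v A⊆D ⟨
      sumSub v (D ─ A)           ∎
      where open ≡-Reasoning

-- Long flat circuits and induced cycles

HasInducedLongCycle : Matroid n → Set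
HasInducedLongCycle M = ∃ λ k → 4 ≤ k × IsoInducedRestriction M (CycleInd k)

module _ (M : Matroid n) where

  inducedCycle⇒longFlatCircuit : HasInducedLongCycle M → HasLongFlatCircuit M
  inducedCycle⇒longFlatCircuit (k , 4≤k , F , F-flat , φ , φ-inj , F≡range , iso) =
    F , (dependent , ind-minus) , F-flat , subst (4 ≤_) (sym ∣F∣≡k) 4≤k
    where
    φi∈F : ∀ i → φ i ∈ F
    φi∈F i = Equivalence.from (F≡range (φ i)) (i , refl)
    F≡image : F ≡ image φ ⊤
    F≡image = Subsetₚ.⊆-antisym sub (λ j∈ → Equivalence.from (F≡range _) (∈-image⇒InImage φ j∈))
      where
      sub : F ⊆ image φ ⊤
      sub {j} j∈F with Equivalence.to (F≡range j) j∈F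
      ... | i , refl = ∈-image⁺ φ Subsetₚ.∈⊤
    ∣F∣≡k : ∣ F ∣ ≡ k
    ∣F∣≡k = trans (cong ∣_∣ F≡image) (trans (∣image∣ φ-inj ⊤) (Subsetₚ.∣⊤∣≡n k))
    dependent : ¬ Ind M F
    dependent ind = ℕₚ.<-irrefl (trans (cong ∣_∣ (preimage≡⊤ φi∈F)) (Subsetₚ.∣⊤∣≡n k))
                                (Equivalence.to (iso F id) ind)
    ind-minus : ∀ x → x ∈ F → Ind M (F - x)
    ind-minus x x∈F with Equivalence.to (F≡range x) x∈F
    ... | i , refl = Equivalence.from (iso (F - φ i) (minus-⊆ F (φ i)))
                       (∉⇒∣p∣<n {x = i} (φi∉F-φi ∘ ∈-preimage⁻ φ {Y = F - φ i}))
      where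
      φi∉F-φi : φ i ∉ F - φ i
      φi∉F-φi = lookup⇒∉ (lookup-minus-x F (φ i))

  longFlatCircuit⇒inducedCycle : HasLongFlatCircuit M → HasInducedLongCycle M
  longFlatCircuit⇒inducedCycle (C , (dependent , ind-minus) , C-flat , 4≤∣C∣) with enumerate C
  ... | χ , χ-inj , C≡range = ∣ C ∣ , 4≤∣C∣ , C , C-flat , χ , χ-inj , C≡range , iso
    where
    iso : ∀ Y → Y ⊆ C → Ind M Y ⇔ CycleInd ∣ C ∣ (preimage χ Y)
    iso Y Y⊆C with ⊆-or-witness C Y
    ... | inj₁ C⊆Y rewrite Subsetₚ.⊆-antisym Y⊆C C⊆Y =
      mk⇔ (⊥-elim ∘ dependent) (⊥-elim ∘ ℕₚ.<-irrefl ∣preimage∣≡∣C∣)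
      where
      ∣preimage∣≡∣C∣ : ∣ preimage χ C ∣ ≡ ∣ C ∣
      ∣preimage∣≡∣C∣ = trans (cong ∣_∣ (preimage≡⊤ λ i → Equivalence.from (C≡range (χ i)) (i , refl)))
                             (Subsetₚ.∣⊤∣≡n ∣ C ∣)
    ... | inj₂ (c , c∈C , c∉Y) with Equivalence.to (C≡range c) c∈C
    ...   | i , refl = mk⇔ (λ _ → ∉⇒∣p∣<n (c∉Y ∘ ∈-preimage⁻ χ))
                           (λ _ → ind-⊆ M (⊆-minus Y⊆C c∉Y) (ind-minus (χ i) c∈C))

-- Cycle matroids

cycleMatroid : ∀ k → Matroid (suc k)
cycleMatroid k = record
  { Ind     = CycleInd (suc k)
  ; ind-∅   = subst (_< suc k) (sym (Subsetₚ.∣⊥∣≡0 (suc k))) (s≤s z≤n)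
  ; ind-⊆   = λ Y⊆X ∣X∣<k → ℕₚ.≤-<-trans (Subsetₚ.p⊆q⇒∣p∣≤∣q∣ Y⊆X) ∣X∣<k
  ; ind-aug = augment
  }
  where
  augment : ∀ {X Y} → ∣ X ∣ < suc k → ∣ Y ∣ < suc k → ∣ X ∣ < ∣ Y ∣ →
            ∃ λ e → e ∈ Y × e ∉ X × ∣ ⁅ e ⁆ ∪ X ∣ < suc k
  augment {X} {Y} _ ∣Y∣<k ∣X∣<∣Y∣ with ⊆-or-witness Y X
  ... | inj₁ Y⊆X = ⊥-elim (ℕₚ.<-irrefl refl (ℕₚ.<-≤-trans ∣X∣<∣Y∣ (Subsetₚ.p⊆q⇒∣p∣≤∣q∣ Y⊆X)))
  ... | inj₂ (e , e∈Y , e∉X) = e , e∈Y , e∉X ,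
    subst (_< suc k) (sym (∣⁅x⁆∪p∣≡1+∣p∣ e∉X)) (s≤s (ℕₚ.≤-trans ∣X∣<∣Y∣ (ℕₚ.≤-pred ∣Y∣<k)))

cycle-contraction : ∀ k → 2 ≤ k → IsoContractSimplify (cycleMatroid (suc k)) (CycleInd (suc k))
cycle-contraction k 2≤k =
  zero , suc , (λ i j → Finₚ.suc-injective) , (λ _ ()) ,
  (λ i → Equivalence.from (contrInd⇔ ⁅ i ⁆)
            (s≤s (subst (_≤ k) (sym (Subsetₚ.∣⁅x⁆∣≡1 i)) (ℕₚ.≤-trans (s≤s z≤n) 2≤k)))) ,
  (λ i j i≢j → Equivalence.from (contrInd⇔ (⁅ i ⁆ ∪ ⁅ j ⁆)) (s≤s (subst (_≤ k) (sym (∣pair∣ i≢j)) 2≤k))) ,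
  (λ { zero 0≢0 _ → ⊥-elim (0≢0 refl) ; (suc i) _ _ → i , inj₁ refl }) ,
  iso
  where
  M = cycleMatroid (suc k)
  ind-0 : Ind M ⁅ zero ⁆
  ind-0 = subst (_< suc (suc k)) (sym (Subsetₚ.∣⁅x⁆∣≡1 {n = suc (suc k)} zero)) (s≤s (s≤s z≤n))
  ∣pair∣ : ∀ {i j : Fin (suc k)} → i ≢ j → ∣ ⁅ i ⁆ ∪ ⁅ j ⁆ ∣ ≡ 2
  ∣pair∣ {i} {j} i≢j =
    trans (∣⁅x⁆∪p∣≡1+∣p∣ (Subsetₚ.x≢y⇒x∉⁅y⁆ i≢j)) (cong suc (Subsetₚ.∣⁅x⁆∣≡1 j))
  contrInd⇔ : ∀ Y → ContrInd M zero (false ∷ Y) ⇔ ∣ Y ∣ < suc k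
  contrInd⇔ Y = mk⇔
    (λ (ind-∪0 , _) → subst (_< suc k) ∣Y∪⊥∣≡∣Y∣ (ℕₚ.≤-pred (ind-∪0 ind-0)))
    (λ ∣Y∣<k → (λ _ → s≤s (subst (_< suc k) (sym ∣Y∪⊥∣≡∣Y∣) ∣Y∣<k)) ,
               (λ ¬ind-0 → ⊥-elim (¬ind-0 ind-0)))
    where
    ∣Y∪⊥∣≡∣Y∣ : ∣ Y ∪ ⊥ ∣ ≡ ∣ Y ∣
    ∣Y∪⊥∣≡∣Y∣ = cong ∣_∣ (Subsetₚ.∪-identityʳ Y)
  iso : ∀ Y → (∀ j → j ∈ Y → InImage suc j) → ContrInd M zero Y ⇔ CycleInd (suc k) (preimage suc Y)
  iso (true  ∷ Y) Y⊆range with Y⊆range zero here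
  ... | _ , ()
  iso (false ∷ Y) _ = subst (λ Y′ → ContrInd M zero (false ∷ Y) ⇔ ∣ Y′ ∣ < suc k)
                            (sym (Vecₚ.tabulate∘lookup Y)) (contrInd⇔ Y)

cycle-minor : ∀ t → IndMinorOf (cycleMatroid (3 + t)) (CycleInd 4)
cycle-minor zero    = done (id , (λ _ _ → id) , (λ j → j , refl) , λ Y →
  subst (λ Y′ → (∣ Y ∣ < 4) ⇔ (∣ Y′ ∣ < 4)) (sym (Vecₚ.tabulate∘lookup Y)) (mk⇔ id id))
cycle-minor (suc t) =
  contr {P = cycleMatroid (3 + t)} (cycle-contraction (3 + t) (s≤s (s≤s z≤n))) (cycle-minor t)

inducedCycle⇒minor : ∀ {M : Matroid n} → HasInducedLongCycle M → IndMinorOf M (CycleInd 4)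
inducedCycle⇒minor (suc (suc (suc (suc t))) , s≤s (s≤s (s≤s (s≤s _))) , restriction) =
  restr {P = cycleMatroid (3 + t)} restriction (cycle-minor t)

-- Lifting closed circuits through a contraction

nonzero⇒coordinate : {u : Vec Bool r} → u ≢ 𝟎 r → ∃[ c ] lookup u c ≡ true
nonzero⇒coordinate {u = u} u≢𝟎 = decidable-stable (Finₚ.any? λ c → lookup u c Boolₚ.≟ true)
  λ ¬coordinate → u≢𝟎 (lookup-ext λ c →
    trans (Boolₚ.¬-not (¬coordinate ∘ (c ,_))) (sym (Vecₚ.lookup-replicate c false)))

module Projection {r} (u : Vec Bool r) (c : Fin r) (u[c] : lookup u c ≡ true) where

  project : Vec Bool r → Vec Bool r
  project z = z ⊕ lookup z c · u

  project-additive : Additive project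
  project-additive z z′ = begin
    (z ⊕ z′) ⊕ lookup (z ⊕ z′) c · u
      ≡⟨ cong (λ b → (z ⊕ z′) ⊕ b · u) (Vecₚ.lookup-zipWith _xor_ c z z′) ⟩
    (z ⊕ z′) ⊕ (lookup z c xor lookup z′ c) · u
      ≡⟨ cong ((z ⊕ z′) ⊕_) (xor-· _ _ u) ⟩
    (z ⊕ z′) ⊕ (lookup z c · u ⊕ lookup z′ c · u)
      ≡⟨ ⊕-interchange z z′ _ _ ⟩
    (z ⊕ lookup z c · u) ⊕ (z′ ⊕ lookup z′ c · u) ∎
    where open ≡-Reasoning

  project-u : project u ≡ 𝟎 r
  project-u rewrite u[c] = ⊕-self u

  project-kernel : ∀ z → project z ≡ 𝟎 r → z ≡ 𝟎 r ⊎ z ≡ u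
  project-kernel z eq with lookup z c | ⊕≡𝟎⇒≡ eq
  ... | true  | z≡u = inj₂ z≡u
  ... | false | z≡𝟎 = inj₁ z≡𝟎

module ContractionLift
  {n r} (v : Fin n → Vec Bool r) (simple : SimpleFamily v) (e : Fin n)
  (g : Vec Bool r → Vec Bool r) (g-additive : Additive g)
  (g-kernel : ∀ z → g z ≡ 𝟎 r → z ≡ 𝟎 r ⊎ z ≡ v e) (g-ve : g (v e) ≡ 𝟎 r)
  where

  open SimpleFamily simple

  w : Fin n → Vec Bool r
  w = g ∘ v

  sumSub-w : ∀ p → sumSub w p ≡ g (sumSub v p)
  sumSub-w = sumSub-additive g-additive v

  g-𝟎 : g (𝟎 r) ≡ 𝟎 r
  g-𝟎 = additive-𝟎 g-additive

  w-≡ : w x ≡ w y → v x ≡ v y ⊎ v x ≡ v y ⊕ v e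
  w-≡ {x} {y} wx≡wy with g-kernel (v x ⊕ v y) (trans (g-additive _ _) (≡⇒⊕≡𝟎 wx≡wy))
  ... | inj₁ vx⊕vy≡𝟎  = inj₁ (⊕≡𝟎⇒≡ vx⊕vy≡𝟎)
  ... | inj₂ vx⊕vy≡ve = inj₂ (⊕-transpose (trans (sym vx⊕vy≡ve) (⊕-comm (v x) (v y))))

  w-nonzero : x ≢ e → w x ≢ 𝟎 r
  w-nonzero {x} x≢e wx≡𝟎 with g-kernel (v x) wx≡𝟎
  ... | inj₁ vx≡𝟎  = nonzero x vx≡𝟎
  ... | inj₂ vx≡ve = x≢e (injective x e vx≡ve)

  InSpan-w : InSpan v p y → InSpan w p y
  InSpan-w (A , A⊆p , vy≡) = A , A⊆p , trans (cong g vy≡) (sym (sumSub-w A))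

  closed-lift : (∀ B → B ⊆ p → v e ≢ sumSub v B) →
                (∀ y → y ≢ e → InSpan w p y → ∃[ c ] (c ∈ p × w y ≡ w c)) → Closed v p
  closed-lift {p} e∉span w-closed y span@(A , A⊆p , vy≡ΣA) with y Fin.≟ e
  ... | yes refl = ⊥-elim (e∉span A A⊆p vy≡ΣA)
  ... | no  y≢e with w-closed y y≢e (InSpan-w span)
  ...   | c , c∈p , wy≡wc with w-≡ wy≡wc
  ...     | inj₁ vy≡vc = subst (_∈ p) (sym (injective y c vy≡vc)) c∈p
  ...     | inj₂ vy≡vc⊕ve = ⊥-elim (e∉span (⁅ c ⁆ Δ A) (Δ-⊆ (⁅x⁆⊆ c∈p) A⊆p) (begin
    v e                           ≡⟨ ⊕-transpose vy≡vc⊕ve ⟩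
    v c ⊕ v y                     ≡⟨ cong₂ _⊕_ (sumSub-⁅⁆ v c) (sym vy≡ΣA) ⟨
    sumSub v ⁅ c ⁆ ⊕ sumSub v A   ≡⟨ sumSub-Δ v ⁅ c ⁆ A ⟨
    sumSub v (⁅ c ⁆ Δ A)          ∎))
    where open ≡-Reasoning

  module _ {D : Subset n} (D-circuit : VecCircuit w D) (e∉D : e ∉ D) (4≤∣D∣ : 4 ≤ ∣ D ∣)
           (D-closed : ∀ y → y ≢ e → InSpan w D y → ∃[ d ] (d ∈ D × w y ≡ w d)) where

    open VecCircuit D-circuit

    D-minimal : p ⊆ D → g (sumSub v p) ≡ 𝟎 r → p ≡ ⊥ ⊎ p ≡ D
    D-minimal {p} p⊆D gΣ≡𝟎 = minimal p p⊆D (trans (sumSub-w p) gΣ≡𝟎)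

    lift-sum≡𝟎 : sumSub v D ≡ 𝟎 r → HasLongClosedCircuit v
    lift-sum≡𝟎 ΣD≡𝟎 = D , D-v-circuit , closed-lift e∉span D-closed , 4≤∣D∣
      where
      D-v-circuit : VecCircuit v D
      D-v-circuit = record
        { nonempty = nonempty
        ; sum≡𝟎    = ΣD≡𝟎
        ; minimal  = λ Z Z⊆D ΣZ≡𝟎 → D-minimal Z⊆D (trans (cong g ΣZ≡𝟎) g-𝟎)
        }
      e∉span : ∀ B → B ⊆ D → v e ≢ sumSub v B
      e∉span B B⊆D ve≡ΣB with D-minimal B⊆D (trans (cong g (sym ve≡ΣB)) g-ve)
      ... | inj₁ refl = nonzero e (trans ve≡ΣB (sumSub-⊥ v))
      ... | inj₂ refl = nonzero e (trans ve≡ΣB ΣD≡𝟎)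

    lift-unpaired : sumSub v D ≡ v e → (∀ d → d ∈ D → ∀ x → v x ≢ v d ⊕ v e) →
                    HasLongClosedCircuit v
    lift-unpaired ΣD≡ve unpaired =
      ⁅ e ⁆ ∪ D , fundamental-circuit v D-independent e∉D (sym ΣD≡ve) , closed ,
      ℕₚ.≤-trans 4≤∣D∣ (Subsetₚ.∣q∣≤∣p∪q∣ ⁅ e ⁆ D)
      where
      D-independent : LinIndepGF2 v D
      D-independent Z Z⊆D ΣZ≡𝟎 with D-minimal Z⊆D (trans (cong g ΣZ≡𝟎) g-𝟎)
      ... | inj₁ Z≡⊥ = Z≡⊥
      ... | inj₂ refl = ⊥-elim (nonzero e (trans (sym ΣD≡ve) ΣZ≡𝟎))
      span-minus-e : InSpan w (⁅ e ⁆ ∪ D) y → InSpan w D y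
      span-minus-e (A , A⊆ , wy≡ΣA) =
        A - e , minus-⊆-∪ A⊆ , trans wy≡ΣA (sym (sumSub-minus-𝟎 w g-ve))
      closed : Closed v (⁅ e ⁆ ∪ D)
      closed y span with y Fin.≟ e
      ... | yes refl = x∈⁅x⁆∪p D e
      ... | no  y≢e with D-closed y y≢e (span-minus-e (InSpan-w span))
      ...   | d , d∈D , wy≡wd with w-≡ wy≡wd
      ...     | inj₁ vy≡vd = Subsetₚ.q⊆p∪q ⁅ e ⁆ D (subst (_∈ D) (sym (injective y d vy≡vd)) d∈D)
      ...     | inj₂ vy≡vd⊕ve = ⊥-elim (unpaired d d∈D y vy≡vd⊕ve)

    module _ {d x : Fin n} (ΣD≡ve : sumSub v D ≡ v e) (d∈D : d ∈ D) (vx≡vd⊕ve : v x ≡ v d ⊕ v e)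
      where

      private
        D′ : Subset n
        D′ = ⁅ x ⁆ ∪ (D - d)

      d∉D-d : d ∉ D - d
      d∉D-d = lookup⇒∉ (lookup-minus-x D d)

      wx≡wd : w x ≡ w d
      wx≡wd = begin
        g (v x)           ≡⟨ cong g vx≡vd⊕ve ⟩
        g (v d ⊕ v e)     ≡⟨ g-additive (v d) (v e) ⟩
        w d ⊕ g (v e)     ≡⟨ cong (w d ⊕_) g-ve ⟩
        w d ⊕ 𝟎 r         ≡⟨ ⊕-identityʳ (w d) ⟩
        w d               ∎
        where open ≡-Reasoning

      x≢d : x ≢ d
      x≢d refl = nonzero e (trans (⊕-transpose vx≡vd⊕ve) (⊕-self (v x)))

      private
        4≰2 : ¬ 4 ≤ 2
        4≰2 (s≤s (s≤s ()))

        x∉⁅d⁆ : x ∉ ⁅ d ⁆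
        x∉⁅d⁆ = Subsetₚ.x≢y⇒x∉⁅y⁆ x≢d

        pair-sum : sumSub w (⁅ x ⁆ ∪ ⁅ d ⁆) ≡ 𝟎 r
        pair-sum =
          trans (sumSub-insert w x∉⁅d⁆) (trans (cong (w x ⊕_) (sumSub-⁅⁆ w d)) (≡⇒⊕≡𝟎 wx≡wd))

        ∣pair∣≡2 : ∣ ⁅ x ⁆ ∪ ⁅ d ⁆ ∣ ≡ 2
        ∣pair∣≡2 = trans (∣⁅x⁆∪p∣≡1+∣p∣ x∉⁅d⁆) (cong suc (Subsetₚ.∣⁅x⁆∣≡1 d))

      x∉D : x ∉ D
      x∉D x∈D with minimal (⁅ x ⁆ ∪ ⁅ d ⁆) (∪-⊆ (⁅x⁆⊆ x∈D) (⁅x⁆⊆ d∈D)) pair-sum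
      ... | inj₁ pair≡⊥ = ∈⇒≢⊥ (x∈⁅x⁆∪p ⁅ d ⁆ x) pair≡⊥
      ... | inj₂ pair≡D = 4≰2 (subst (4 ≤_) (trans (cong ∣_∣ (sym pair≡D)) ∣pair∣≡2) 4≤∣D∣)

      D-d-independent : LinIndepGF2 v (D - d)
      D-d-independent Z Z⊆ ΣZ≡𝟎 with D-minimal (minus-⊆ D d ∘ Z⊆) (trans (cong g ΣZ≡𝟎) g-𝟎)
      ... | inj₁ Z≡⊥  = Z≡⊥
      ... | inj₂ refl = ⊥-elim (d∉D-d (Z⊆ d∈D))

      vx≡Σ[D-d] : v x ≡ sumSub v (D - d)
      vx≡Σ[D-d] = trans vx≡vd⊕ve (sym (⊕-transpose (trans (sym ΣD≡ve) (sumSub-minus v d∈D))))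

      private
        ⊆D′⇒⊆D-d : p ⊆ D′ → x ∉ p → p ⊆ D - d
        ⊆D′⇒⊆D-d p⊆D′ x∉p = subst (_⊆ D - d) (minus-∉ x∉p) (minus-⊆-∪ p⊆D′)

        exchange-⊆ : p ⊆ D′ → ⁅ d ⁆ ∪ (p - x) ⊆ D
        exchange-⊆ p⊆D′ = ∪-⊆ (⁅x⁆⊆ d∈D) (minus-⊆ D d ∘ minus-⊆-∪ p⊆D′)

        exchange-sum : ∀ (u : Fin n → Vec Bool r) → p ⊆ D′ → x ∈ p →
                       sumSub u (⁅ d ⁆ ∪ (p - x)) ≡ u d ⊕ (u x ⊕ sumSub u p)
        exchange-sum u p⊆D′ x∈p =
          trans (sumSub-insert u (d∉D-d ∘ minus-⊆-∪ p⊆D′))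
                (cong (u d ⊕_) (⊕-transpose (sumSub-minus u x∈p)))

        exchange-sum≡𝟎 : p ⊆ D′ → x ∈ p → v e ≡ sumSub v p →
                         sumSub v (⁅ d ⁆ ∪ (p - x)) ≡ 𝟎 r
        exchange-sum≡𝟎 {p} p⊆D′ x∈p ve≡Σp = begin
          sumSub v (⁅ d ⁆ ∪ (p - x))      ≡⟨ exchange-sum v p⊆D′ x∈p ⟩
          v d ⊕ (v x ⊕ sumSub v p)        ≡⟨ cong (λ z → v d ⊕ (v x ⊕ z)) ve≡Σp ⟨
          v d ⊕ (v x ⊕ v e)               ≡⟨ cong (λ z → v d ⊕ (z ⊕ v e)) vx≡vd⊕ve ⟩
          v d ⊕ ((v d ⊕ v e) ⊕ v e)       ≡⟨ cong (v d ⊕_) (⊕-cancelʳ (v d) (v e)) ⟩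
          v d ⊕ v d                       ≡⟨ ⊕-self (v d) ⟩
          𝟎 r                             ∎
          where open ≡-Reasoning

      e∉span : ∀ B → B ⊆ D′ → v e ≢ sumSub v B
      e∉span B B⊆D′ ve≡ΣB with x Subsetₚ.∈? B
      ... | no x∉B
        with D-minimal (minus-⊆ D d ∘ ⊆D′⇒⊆D-d B⊆D′ x∉B) (trans (cong g (sym ve≡ΣB)) g-ve)
      ...   | inj₁ refl = nonzero e (trans ve≡ΣB (sumSub-⊥ v))
      ...   | inj₂ refl = d∉D-d (⊆D′⇒⊆D-d B⊆D′ x∉B d∈D)
      e∉span B B⊆D′ ve≡ΣB | yes x∈B
        with D-minimal (exchange-⊆ B⊆D′) (trans (cong g (exchange-sum≡𝟎 B⊆D′ x∈B ve≡ΣB)) g-𝟎)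
      ...   | inj₁ B′≡⊥ = ∈⇒≢⊥ (x∈⁅x⁆∪p (B - x) d) B′≡⊥
      ...   | inj₂ refl = nonzero e (trans (sym ΣD≡ve) (exchange-sum≡𝟎 B⊆D′ x∈B ve≡ΣB))

      D′-w-closed : ∀ y → y ≢ e → InSpan w D′ y → ∃[ c ] (c ∈ D′ × w y ≡ w c)
      D′-w-closed y y≢e span = parallel-in-D′ (D-closed y y≢e (span-in-D span))
        where
        span-in-D : InSpan w D′ y → InSpan w D y
        span-in-D (A , A⊆D′ , wy≡ΣA) with x Subsetₚ.∈? A
        ... | no  x∉A = A , minus-⊆ D d ∘ ⊆D′⇒⊆D-d A⊆D′ x∉A , wy≡ΣA
        ... | yes x∈A = ⁅ d ⁆ ∪ (A - x) , exchange-⊆ A⊆D′ , (begin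
          w y                             ≡⟨ wy≡ΣA ⟩
          sumSub w A                      ≡⟨ ⊕-cancelˡ (w x) (sumSub w A) ⟨
          w x ⊕ (w x ⊕ sumSub w A)        ≡⟨ cong (_⊕ (w x ⊕ sumSub w A)) wx≡wd ⟩
          w d ⊕ (w x ⊕ sumSub w A)        ≡⟨ exchange-sum w A⊆D′ x∈A ⟨
          sumSub w (⁅ d ⁆ ∪ (A - x))      ∎)
          where open ≡-Reasoning
        parallel-in-D′ : ∃[ d′ ] (d′ ∈ D × w y ≡ w d′) → ∃[ c ] (c ∈ D′ × w y ≡ w c)
        parallel-in-D′ (d′ , d′∈D , wy≡wd′) with d Fin.≟ d′
        ... | yes refl = x , x∈⁅x⁆∪p (D - d) x , trans wy≡wd′ (sym wx≡wd)
        ... | no  d≢d′ =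
          d′ , Subsetₚ.q⊆p∪q ⁅ x ⁆ (D - d) (Subsetₚ.x∈p∧x≢y⇒x∈p-y d′∈D (d≢d′ ∘ sym)) , wy≡wd′

      lift-paired : HasLongClosedCircuit v
      lift-paired =
        D′ , fundamental-circuit v D-d-independent (x∉D ∘ minus-⊆ D d) vx≡Σ[D-d] ,
        closed-lift e∉span D′-w-closed , subst (4 ≤_) ∣D∣≡∣D′∣ 4≤∣D∣
        where
        ∣D∣≡∣D′∣ : ∣ D ∣ ≡ ∣ D′ ∣
        ∣D∣≡∣D′∣ = trans (∣p∣≡1+∣p-x∣ d∈D) (sym (∣⁅x⁆∪p∣≡1+∣p∣ (x∉D ∘ minus-⊆ D d)))

    lift : HasLongClosedCircuit v
    lift with g-kernel (sumSub v D) (trans (sym (sumSub-w D)) sum≡𝟎)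
    ... | inj₁ ΣD≡𝟎 = lift-sum≡𝟎 ΣD≡𝟎
    ... | inj₂ ΣD≡ve
      with Finₚ.any? (λ d → d Subsetₚ.∈? D ×-dec Finₚ.any? λ x → Vecₚ.≡-dec Boolₚ._≟_ (v x) (v d ⊕ v e))
    ...   | yes (d , d∈D , x , vx≡vd⊕ve) = lift-paired ΣD≡ve d∈D vx≡vd⊕ve
    ...   | no  ¬paired = lift-unpaired ΣD≡ve λ d d∈D x vx≡vd⊕ve → ¬paired (d , d∈D , x , vx≡vd⊕ve)

-- Lifting along induced restrictions and contractions

module ⇔-Reasoning = Relation.Binary.Reasoning.Setoid (⇔-setoid 0ℓ)

module RestrictionStep
  {M : Matroid n} {v : Fin n → Vec Bool r} (rep : Represents M v) (simple : SimpleFamily v)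
  {k} {P : Matroid k} {F : Subset n} (F-flat : Flat M F) {φ : Fin k → Fin n} (φ-inj : Injective φ)
  (F≡range : ∀ j → j ∈ F ⇔ InImage φ j) (iso : ∀ Y → Y ⊆ F → Ind M Y ⇔ Ind P (preimage φ Y))
  where

  open SimpleFamily simple

  image⊆F : ∀ X → image φ X ⊆ F
  image⊆F X j∈ with ∈-image⁻ φ j∈
  ... | i , _ , refl = Equivalence.from (F≡range (φ i)) (i , refl)

  represented : Represents P (v ∘ φ)
  represented = mkRepresents λ X → begin
    Ind P X                        ≡⟨ cong (Ind P) (preimage-image φ φ-inj X) ⟨
    Ind P (preimage φ (image φ X)) ≈⟨ iso (image φ X) (image⊆F X) ⟨
    Ind M (image φ X)              ≈⟨ Represents.ind⇔LI rep (image φ X) ⟩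
    LinIndepGF2 v (image φ X)      ≈⟨ LI-image v φ-inj X ⟨
    LinIndepGF2 (v ∘ φ) X          ∎
    where open ⇔-Reasoning

  simple-restricted : SimpleFamily (v ∘ φ)
  simple-restricted = record
    { nonzero   = nonzero ∘ φ
    ; injective = λ i j vφi≡vφj → φ-inj i j (injective (φ i) (φ j) vφi≡vφj)
    }

  lift : HasLongClosedCircuit (v ∘ φ) → HasLongClosedCircuit v
  lift (C , circuit , closed , 4≤∣C∣) =
    image φ C , image-circuit , image-closed , subst (4 ≤_) (sym (∣image∣ φ-inj C)) 4≤∣C∣
    where
    image-circuit : VecCircuit v (image φ C)
    image-circuit = VecCircuit-image v φ-inj circuit
    image-closed : Closed v (image φ C)
    image-closed y span
      with Equivalence.to (F≡range y) (flat-InSpan rep simple F-flat image-circuit (image⊆F C) span)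
    ... | i , refl = ∈-image⁺ φ (closed i (InSpan-image v φ-inj span refl))

module ContractionStep
  {M : Matroid n} {v : Fin n → Vec Bool r} (rep : Represents M v) (simple : SimpleFamily v)
  {k} {P : Matroid k} (e : Fin n) {φ : Fin k → Fin n} (φ-inj : Injective φ) (φ≢e : ∀ i → φ i ≢ e)
  (ind-pair : ∀ i j → i ≢ j → ContrInd M e (⁅ φ i ⁆ ∪ ⁅ φ j ⁆))
  (cover : ∀ f → f ≢ e → ContrInd M e ⁅ f ⁆ →
           ∃ λ i → (f ≡ φ i) ⊎ ¬ ContrInd M e (⁅ f ⁆ ∪ ⁅ φ i ⁆))
  (iso : ∀ Y → (∀ j → j ∈ Y → InImage φ j) → ContrInd M e Y ⇔ Ind P (preimage φ Y))
  where

  open SimpleFamily simple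

  private
    coordinate : ∃[ c ] lookup (v e) c ≡ true
    coordinate = nonzero⇒coordinate (nonzero e)

  open Projection (v e) (coordinate .proj₁) (coordinate .proj₂)
  module Lift = ContractionLift v simple e project project-additive project-kernel project-u
  open Lift using (w; w-nonzero; sumSub-w)

  private
    ind⇒LI : Ind M p → LinIndepGF2 v p
    ind⇒LI = Equivalence.to (Represents.ind⇔LI rep _)

    LI⇒ind : LinIndepGF2 v p → Ind M p
    LI⇒ind = Equivalence.from (Represents.ind⇔LI rep _)

    project-𝟎 : project (𝟎 r) ≡ 𝟎 r
    project-𝟎 = additive-𝟎 project-additive

  ind-e : Ind M ⁅ e ⁆
  ind-e = LI⇒ind (LI-single v (nonzero e))

  LI-contraction : {Y : Subset n} → e ∉ Y → LinIndepGF2 w Y ⇔ LinIndepGF2 v (Y ∪ ⁅ e ⁆)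
  LI-contraction {Y} e∉Y = mk⇔ to from
    where
    to : LinIndepGF2 w Y → LinIndepGF2 v (Y ∪ ⁅ e ⁆)
    to li = subst (LinIndepGF2 v) (Subsetₚ.∪-comm ⁅ e ⁆ Y) (LI-insert v LI-v e∉span)
      where
      LI-v : LinIndepGF2 v Y
      LI-v Z Z⊆Y ΣZ≡𝟎 = li Z Z⊆Y (trans (sumSub-w Z) (trans (cong project ΣZ≡𝟎) project-𝟎))
      e∉span : ¬ InSpan v Y e
      e∉span (B , B⊆Y , ve≡ΣB) with li B B⊆Y (trans (sumSub-w B) (trans (cong project (sym ve≡ΣB)) project-u))
      ... | refl = nonzero e (trans ve≡ΣB (sumSub-⊥ v))
    from : LinIndepGF2 v (Y ∪ ⁅ e ⁆) → LinIndepGF2 w Y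
    from li Z Z⊆Y ΣZ≡𝟎 with project-kernel (sumSub v Z) (trans (sym (sumSub-w Z)) ΣZ≡𝟎)
    ... | inj₁ ΣvZ≡𝟎  = li Z (Subsetₚ.p⊆p∪q ⁅ e ⁆ ∘ Z⊆Y) ΣvZ≡𝟎
    ... | inj₂ ΣvZ≡ve = ⊥-elim (∈⇒≢⊥ (x∈⁅x⁆∪p Z e) (li (⁅ e ⁆ ∪ Z) eZ⊆ eZ-sum))
      where
      e∉Z : e ∉ Z
      e∉Z = e∉Y ∘ Z⊆Y
      eZ⊆ : ⁅ e ⁆ ∪ Z ⊆ Y ∪ ⁅ e ⁆
      eZ⊆ = ∪-⊆ (Subsetₚ.q⊆p∪q Y ⁅ e ⁆) (Subsetₚ.p⊆p∪q ⁅ e ⁆ ∘ Z⊆Y)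
      eZ-sum : sumSub v (⁅ e ⁆ ∪ Z) ≡ 𝟎 r
      eZ-sum = trans (sumSub-insert v e∉Z) (≡⇒⊕≡𝟎 (sym ΣvZ≡ve))

  contrInd⇔LI : {Y : Subset n} → e ∉ Y → ContrInd M e Y ⇔ LinIndepGF2 w Y
  contrInd⇔LI e∉Y = mk⇔
    (λ (ind-∪e , _) → Equivalence.from (LI-contraction e∉Y) (ind⇒LI (ind-∪e ind-e)))
    (λ li → (λ _ → LI⇒ind (Equivalence.to (LI-contraction e∉Y) li)) , (λ ¬ind-e → ⊥-elim (¬ind-e ind-e)))

  e∉image : ∀ X → e ∉ image φ X
  e∉image X e∈ with ∈-image⁻ φ e∈
  ... | i , _ , φi≡e = φ≢e i φi≡e

  represented : Represents P (w ∘ φ)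
  represented = mkRepresents λ X → begin
    Ind P X                              ≡⟨ cong (Ind P) (preimage-image φ φ-inj X) ⟨
    Ind P (preimage φ (image φ X))       ≈⟨ iso (image φ X) (λ _ → ∈-image⇒InImage φ) ⟨
    ContrInd M e (image φ X)             ≈⟨ contrInd⇔LI (e∉image X) ⟩
    LinIndepGF2 w (image φ X)            ≈⟨ LI-image w φ-inj X ⟨
    LinIndepGF2 (w ∘ φ) X                ∎
    where open ⇔-Reasoning

  private
    e∉⁅_⁆ : ∀ {a} → a ≢ e → e ∉ ⁅ a ⁆
    e∉⁅ a≢e ⁆ = Subsetₚ.x≢y⇒x∉⁅y⁆ (a≢e ∘ sym)

    e∉pair : ∀ {a b} → a ≢ e → b ≢ e → e ∉ ⁅ a ⁆ ∪ ⁅ b ⁆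
    e∉pair {a} {b} a≢e b≢e e∈ with Subsetₚ.x∈p∪q⁻ ⁅ a ⁆ ⁅ b ⁆ e∈
    ... | inj₁ e∈⁅a⁆ = e∉⁅ a≢e ⁆ e∈⁅a⁆
    ... | inj₂ e∈⁅b⁆ = e∉⁅ b≢e ⁆ e∈⁅b⁆

  simple-contracted : SimpleFamily (w ∘ φ)
  simple-contracted = record { nonzero = w-nonzero ∘ φ≢e ; injective = injective′ }
    where
    injective′ : ∀ i j → w (φ i) ≡ w (φ j) → i ≡ j
    injective′ i j wφi≡wφj with i Fin.≟ j
    ... | yes i≡j = i≡j
    ... | no  i≢j = ⊥-elim (LI-pair⇒≢ w (i≢j ∘ φ-inj i j)
          (Equivalence.to (contrInd⇔LI (e∉pair (φ≢e i) (φ≢e j))) (ind-pair i j i≢j)) wφi≡wφj)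

  parallel-representative : ∀ y → y ≢ e → ∃[ i ] w y ≡ w (φ i)
  parallel-representative y y≢e
    with cover y y≢e (Equivalence.from (contrInd⇔LI e∉⁅ y≢e ⁆) (LI-single w (w-nonzero y≢e)))
  ... | i , inj₁ refl = i , refl
  ... | i , inj₂ ¬ind with Vecₚ.≡-dec Boolₚ._≟_ (w y) (w (φ i))
  ...   | yes wy≡wφi = i , wy≡wφi
  ...   | no  wy≢wφi = ⊥-elim (¬ind (Equivalence.from (contrInd⇔LI (e∉pair y≢e (φ≢e i)))
                                      (LI-pair w (w-nonzero y≢e) (w-nonzero (φ≢e i)) wy≢wφi)))

  lift : HasLongClosedCircuit (w ∘ φ) → HasLongClosedCircuit v
  lift (C , circuit , closed , 4≤∣C∣) = Lift.lift (VecCircuit-image w φ-inj circuit) (e∉image C)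
    (subst (4 ≤_) (sym (∣image∣ φ-inj C)) 4≤∣C∣) image-closed
    where
    image-closed : ∀ y → y ≢ e → InSpan w (image φ C) y → ∃[ d ] (d ∈ image φ C × w y ≡ w d)
    image-closed y y≢e span with parallel-representative y y≢e
    ... | i , wy≡wφi = φ i , ∈-image⁺ φ (closed i (InSpan-image w φ-inj span wy≡wφi)) , wy≡wφi

-- Induced minors

isomorphic⇒inducedRestriction : ∀ {k} {M : Matroid n} {N : IndPred k} →
                                IsoMatroid M N → IsoInducedRestriction M N
isomorphic⇒inducedRestriction (φ , φ-inj , φ-onto , iso) =
  ⊤ , (λ _ _ _ _ _ → Subsetₚ.∈⊤) , φ , φ-inj , (λ j → mk⇔ (λ _ → φ-onto j) (λ _ → Subsetₚ.∈⊤)) ,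
  λ Y _ → iso Y

minor⇒longClosedCircuit : ∀ {k} {M : Matroid n} {v : Fin n → Vec Bool r} →
                          Represents M v → SimpleFamily v → 4 ≤ k → IndMinorOf M (CycleInd k) →
                          HasLongClosedCircuit v
minor⇒longClosedCircuit {M = M} rep simple 4≤k (done iso) = Equivalence.to (longFlatCircuit⇔ rep simple)
  (inducedCycle⇒longFlatCircuit M (_ , 4≤k , isomorphic⇒inducedRestriction {M = M} {N = CycleInd _} iso))
minor⇒longClosedCircuit rep simple 4≤k (restr {P = P} (F , F-flat , φ , φ-inj , F≡range , iso) minor) =
  R.lift (minor⇒longClosedCircuit R.represented R.simple-restricted 4≤k minor)
  where module R = RestrictionStep rep simple {P = P} F-flat φ-inj F≡range iso
-- The condition that the representatives φ i are not loops of M/e is implied by simplicity of M.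
minor⇒longClosedCircuit rep simple 4≤k
  (contr {P = P} (e , φ , φ-inj , φ≢e , _ , ind-pair , cover , iso) minor) =
  C.lift (minor⇒longClosedCircuit C.represented C.simple-contracted 4≤k minor)
  where module C = ContractionStep rep simple {P = P} e φ-inj φ≢e ind-pair cover iso

theorem2p2 : ∀ {n} (M : Matroid n) → Simple M → Binary M →
    (Chordal M ⇔ (¬ IndMinorOf M (CycleInd 4))) ×
    (Chordal M ⇔ (¬ (∃ λ k → 4 ≤ k × IsoInducedRestriction M (CycleInd k))))
theorem2p2 M simple (_ , v , ind⇔LI) =
  mk⇔ (λ chordal → chordal⇒¬longFlatCircuit M chordal ∘ minor⇒longFlatCircuit)
      (λ ¬minor → ¬longFlatCircuit⇒chordal rep simpleᵛ (¬minor ∘ longFlatCircuit⇒minor)) ,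
  mk⇔ (λ chordal → chordal⇒¬longFlatCircuit M chordal ∘ inducedCycle⇒longFlatCircuit M)
      (λ ¬cycle → ¬longFlatCircuit⇒chordal rep simpleᵛ (¬cycle ∘ longFlatCircuit⇒inducedCycle M))
  where
  rep : Represents M v
  rep = mkRepresents ind⇔LI
  simpleᵛ : SimpleFamily v
  simpleᵛ = simple⇒SimpleFamily rep simple
  minor⇒longFlatCircuit : IndMinorOf M (CycleInd 4) → HasLongFlatCircuit M
  minor⇒longFlatCircuit =
    Equivalence.from (longFlatCircuit⇔ rep simpleᵛ) ∘ minor⇒longClosedCircuit rep simpleᵛ ℕₚ.≤-refl
  longFlatCircuit⇒minor : HasLongFlatCircuit M → IndMinorOf M (CycleInd 4)
  longFlatCircuit⇒minor = inducedCycle⇒minor ∘ longFlatCircuit⇒inducedCycle M
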